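{- Let $n,m\ge 3$ be odd integers, let $S$ be a 2-partition of $\mathbb{Z}_n^*$ and $T$ a 2-partition of $\mathbb{Z}_m^*$, and let $W_{ST}$ be any product of $S$ and $T$ (for any admissible choice of $\tilde S$ and $\bar T$). 1. If both $S$ and $T$ are Skolem starters and, in addition, $S$ is strong and $T$ is skew, then $W_{ST}$ is a strong Skolem starter in $\mathbb{Z}_{nm}$. Moreover, if $S$ and $T$ are both skew Skolem starters in their groups, then $W_{ST}$ is a skew Skolem starter in $\mathbb{Z}_{nm}$. 2. If $W_{ST}$ is a strong but not skew Skolem starter, then $S$ is a strong but not skew Skolem starter and $T$ is a skew Skolem starter. If $W_{ST}$ is a skew Skolem starter, then both $S$ and $T$ are skew Skolem starters.
   Context: For odd $k=2\ell+1\ge3$, $\mathbb{Z}_k^*=\mathbb{Z}_k\setminus\{0\}$ with order $1<2<\dots<k-1$. A 2-partition of $\mathbb{Z}_k^*$ is a partition into $\ell$ unordered pairs $\{x_i,y_i\}$; it is a starter in $\mathbb{Z}_k$ if $\{\pm(x_i-y_i)\bmod k\}=\mathbb{Z}_k^*$; strong if the sums $x_i+y_i\bmod k$ are nonzero and pairwise distinct; skew if $\{\pm(x_i+y_i)\bmod k\}=\mathbb{Z}_k^*$; Skolem if every pair $\{x,y\}$ with $x<y$ satisfies $y-x\le \ell$. A (strong/skew) Skolem starter is a starter that is (strong/skew and) Skolem. Product: let $S$ be a 2-partition of $\mathbb{Z}_n^*$, $n=2q+1$, and $T$ a 2-partition of $\mathbb{Z}_m^*$, $m=2p+1$. Let $\tilde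 S$ be any set of ordered pairs obtained by ordering each pair of $S$ in either way. Let $\bar T=\{(r_j,t_j)\}_{j=1}^p$ be obtained by ordering each pair of $T$ so that $\bigcup_j\{\pm r_j\}=\mathbb{Z}_m^*$ (such orderings always exist), and $\bar T'=\{(-r_j,-t_j)\}_{j=1}^p$. A product $W_{ST}$ of $S$ and $T$ is the collection of $2pq+p+q$ unordered pairs $\{nr+x,\ nt+y\}$ (taken mod $nm$, with $x,y$ represented in $\{0,\dots,n-1\}$) of two types: (i) one pair for each $(r,t)\in\bar T\cup\bar T'\cup\{(0,0)\}$ and each $(x,y)\in\tilde S$; (ii) one pair for each $(r,t)\in\bar T$ with $x=y=0$. -}

module Defs where

open import Data.Nat using (ℕ; zero; suc; _+_; _*_; _∸_; _≤_; _<_; ⌊_/2⌋)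
open import Data.Nat.DivMod using (_%_)
open import Data.Product using (_×_; _,_; proj₁; proj₂)
open import Data.Sum using (_⊎_)
open import Data.List using (List; []; _∷_; _++_; map; concatMap; upTo)
open import Data.List.Membership.Propositional using (_∈_)
open import Data.List.Relation.Unary.All using (All)
open import Data.List.Relation.Unary.Unique.Propositional using (Unique)
open import Data.List.Relation.Binary.Pointwise using (Pointwise)
open import Data.List.Relation.Binary.Permutation.Propositional using (_↭_)
open import Relation.Binary.PropositionalEquality using (_≡_; _≢_)

-- Elements of ℤ_k are represented by naturals in {0,…,k-1}; ℤ_k^* = {1,…,k-1}.
-- Reduction mod k (all moduli used are ≥ 3; the zero case is a dummy).
mod : ℕ → ℕ → ℕ
mod a zero    = a
mod a (suc k) = a % suc k

neg : ℕ → ℕ → ℕ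
neg k a = mod (k ∸ mod a k) k

sub : ℕ → ℕ → ℕ → ℕ
sub k a b = mod (a + neg k b) k

add : ℕ → ℕ → ℕ → ℕ
add k a b = mod (a + b) k

Odd : ℕ → Set
Odd k = k % 2 ≡ 1

-- ℓ = (k-1)/2 for odd k
half : ℕ → ℕ
half k = ⌊ k /2⌋

-- an (unordered) pair is represented by an ordered pair; all predicates below are symmetric
Pair : Set
Pair = ℕ × ℕ

Zstar : ℕ → List ℕ
Zstar k = map suc (upTo (k ∸ 1))

CoversStar : ℕ → List ℕ → Set
CoversStar k L = (z : ℕ) → (z ∈ L → (1 ≤ z × z < k)) × ((1 ≤ z × z < k) → z ∈ L)

elems : List Pair → List ℕ
elems P = concatMap (λ p → proj₁ p ∷ proj₂ p ∷ []) P

TwoPartition : ℕ → List Pair → Set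
TwoPartition k P = elems P ↭ Zstar k

pmDiffs : ℕ → List Pair → List ℕ
pmDiffs k P = concatMap (λ p → sub k (proj₁ p) (proj₂ p) ∷ neg k (sub k (proj₁ p) (proj₂ p)) ∷ []) P

pmSums : ℕ → List Pair → List ℕ
pmSums k P = concatMap (λ p → add k (proj₁ p) (proj₂ p) ∷ neg k (add k (proj₁ p) (proj₂ p)) ∷ []) P

Starter : ℕ → List Pair → Set
Starter k P = TwoPartition k P × CoversStar k (pmDiffs k P)

Strong : ℕ → List Pair → Set
Strong k P = All (λ p → add k (proj₁ p) (proj₂ p) ≢ 0) P × Unique (map (λ p → add k (proj₁ p) (proj₂ p)) P)

Skew : ℕ → List Pair → Set
Skew k P = CoversStar k (pmSums k P)

Skolem : ℕ → List Pair → Set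
Skolem k P = All (λ p → (proj₁ p < proj₂ p → proj₂ p ∸ proj₁ p ≤ half k)
                      × (proj₂ p < proj₁ p → proj₁ p ∸ proj₂ p ≤ half k)) P

StrongSkolemStarter : ℕ → List Pair → Set
StrongSkolemStarter k P = Starter k P × Strong k P × Skolem k P

SkewSkolemStarter : ℕ → List Pair → Set
SkewSkolemStarter k P = Starter k P × Skew k P × Skolem k P

SameUnordered : Pair → Pair → Set
SameUnordered a b = (proj₁ a ≡ proj₁ b × proj₂ a ≡ proj₂ b) ⊎ (proj₁ a ≡ proj₂ b × proj₂ a ≡ proj₁ b)

IsOrdering : List Pair → List Pair → Set
IsOrdering S̃ S = Pointwise SameUnordered S̃ S

IsBarOrdering : ℕ → List Pair → List Pair → Set
IsBarOrdering m T̄ T = IsOrdering T̄ T × CoversStar m (concatMap (λ p → proj₁ p ∷ neg m (proj₁ p) ∷ []) T̄)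

product : ℕ → ℕ → List Pair → List Pair → List Pair
product n m S̃ T̄ = typeI ++ typeII
  where
  T̄' : List Pair
  T̄' = map (λ p → neg m (proj₁ p) , neg m (proj₂ p)) T̄
  typeI : List Pair
  typeI = concatMap (λ rt → map (λ xy → mod (n * proj₁ rt + proj₁ xy) (n * m)
                                      , mod (n * proj₂ rt + proj₂ xy) (n * m)) S̃)
                    (T̄ ++ T̄' ++ ((0 , 0) ∷ []))
  typeII : List Pair
  typeII = map (λ rt → mod (n * proj₁ rt) (n * m) , mod (n * proj₂ rt) (n * m)) T̄

-- Write residues of ℤ_nm in mixed radix as n a + b with a ∈ ℤ_m, b ∈ ℤ_n. A type (i) pair {n r + x, n t + y}
-- has difference n (r - t) + (x - y) and sum n (r + t) + (x + y): modulo n it only sees the pair {x, y} of S,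
-- while (r, t) runs over T̄ ∪ T̄' ∪ {(0, 0)}, whose differences (and, for T skew, sums) hit every residue
-- modulo m, so the carry from the low digits can always be absorbed; the type (ii) pairs n{r, t} take care of
-- b = 0. Hence the ± differences (sums) of W cover ℤ_nm^* when those of S and T cover ℤ_n^* and ℤ_m^*, W is a
-- 2-partition by counting, and the Skolem bound (nm - 1)/2 = q + n p follows from |r - t| ≤ p and |x - y| ≤ q.
-- Conversely, reducing modulo n recovers S, the type (ii) pairs recover T, a pair of T̄ at distance exactly p
-- transfers the Skolem bound back to S, and distinct sums in W force distinct sums on T̄ ∪ T̄' ∪ {(0, 0)},
-- which by counting makes T skew.

module Submission where

open import Defs
open import Data.Empty using (⊥; ⊥-elim)
open import Data.Product using (_×_; _,_; proj₁; proj₂; Σ; ∃)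
open import Data.Sum using (_⊎_; inj₁; inj₂)
open import Function using (_∘_)
open import Relation.Nullary using (¬_; yes; no)
open import Relation.Binary.Bundles using (Setoid)
open import Relation.Binary.Definitions using (tri<; tri≈; tri>)
open import Relation.Binary.PropositionalEquality
  using (_≡_; _≢_; refl; sym; trans; cong; cong₂; subst; subst₂; setoid; module ≡-Reasoning)
import Relation.Binary.Reasoning.Setoid as SetoidReasoning

open import Data.Nat using (ℕ; zero; suc; _+_; _*_; _∸_; _≤_; _<_; z≤n; s≤s; ⌊_/2⌋)
open import Data.Nat.Properties
open import Data.Nat.DivMod using (_%_; _/_; m≡m%n+[m/n]*n; m%n<n; m<n⇒m%n≡m; m<n*o⇒m/o<n)
import Data.Nat.Tactic.RingSolver as ℕ
open import Data.Integer as ℤ using (ℤ; +_; -[1+_])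
  renaming (_+_ to _+ᶻ_; _*_ to _*ᶻ_; _-_ to _-ᶻ_; -_ to -ᶻ_)
import Data.Integer.Properties as ℤ
import Data.Integer.DivMod as ℤ
open import Data.Integer.Tactic.RingSolver using (solve-∀)

open import Data.List using (List; []; _∷_; _++_; map; concat; concatMap; upTo; length)
open import Data.List.Properties using (length-map; length-++; length-upTo; map-++; map-∘; map-cong; ++-assoc)
open import Data.List.Membership.Propositional using (_∈_; find; lose)
open import Data.List.Membership.Propositional.Properties
  using (∈-map⁺; ∈-map⁻; ∈-++⁺ˡ; ∈-++⁺ʳ; ∈-++⁻; ∈-∃++; ∈-upTo⁺; ∈-upTo⁻; ∈-concatMap⁺; ∈-concatMap⁻)
open import Data.List.Relation.Binary.Subset.Propositional using (_⊆_)
open import Data.List.Relation.Binary.Pointwise using ([]; _∷_)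
open import Data.List.Relation.Binary.Permutation.Propositional
  using (_↭_; ↭-sym; ↭-trans; prep; swap; ↭⇒↭ₛ)
import Data.List.Relation.Binary.Permutation.Propositional as ↭
open import Data.List.Relation.Binary.Permutation.Propositional.Properties using (∈-resp-↭; ↭-length; shift)
import Data.List.Relation.Binary.Permutation.Setoid.Properties as ↭ₛ
open import Data.List.Relation.Unary.Any using (here; there)
open import Data.List.Relation.Unary.All as All using (All; []; _∷_)
import Data.List.Relation.Unary.All.Properties as All
open import Data.List.Relation.Unary.AllPairs using ([]; _∷_)
open import Data.List.Relation.Unary.Unique.Propositional using (Unique)
import Data.List.Relation.Unary.Unique.Propositional.Properties as Unique

private variable
  A B : Set

Unique-resp-↭ : ∀ {xs ys : List A} → xs ↭ ys → Unique xs → Unique ys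
Unique-resp-↭ {A} p = ↭ₛ.Unique-resp-↭ (setoid A) (↭⇒↭ₛ p)

Unique-++⁻ˡ : ∀ xs {ys : List A} → Unique (xs ++ ys) → Unique xs
Unique-++⁻ˡ []       _        = []
Unique-++⁻ˡ (x ∷ xs) (px ∷ u) = All.++⁻ˡ xs px ∷ Unique-++⁻ˡ xs u

Unique-++⁻ʳ : ∀ xs {ys : List A} → Unique (xs ++ ys) → Unique ys
Unique-++⁻ʳ []       u        = u
Unique-++⁻ʳ (x ∷ xs) (_ ∷ u) = Unique-++⁻ʳ xs u

Unique-++⇒disjoint : ∀ xs {ys : List A} {z} → Unique (xs ++ ys) → z ∈ xs → z ∈ ys → ⊥
Unique-++⇒disjoint (x ∷ xs) (px ∷ _) (here refl) z∈ys = All.lookup px (∈-++⁺ʳ xs z∈ys) refl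
Unique-++⇒disjoint (x ∷ xs) (_ ∷ u)  (there z∈)  z∈ys = Unique-++⇒disjoint xs u z∈ z∈ys

∈⇒↭-∷ : ∀ {z} {L : List A} → z ∈ L → Σ (List A) λ L' → L ↭ z ∷ L'
∈⇒↭-∷ z∈ with ∈-∃++ z∈
... | ys , zs , refl = ys ++ zs , shift _ ys zs

⊆-unique-length⇒↭ : ∀ (M L : List A) → Unique M → M ⊆ L → length L ≤ length M → L ↭ M
⊆-unique-length⇒↭ []      []      _        _   _  = ↭.refl
⊆-unique-length⇒↭ (z ∷ M) L       (pz ∷ u) M⊆L le with ∈⇒↭-∷ (M⊆L (here refl))
... | L' , L↭ = ↭-trans L↭ (prep z (⊆-unique-length⇒↭ M L' u M⊆L' le'))
  where
  M⊆L' : M ⊆ L'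
  M⊆L' w∈ with ∈-resp-↭ L↭ (M⊆L (there w∈))
  ... | here e  = ⊥-elim (All.lookup pz w∈ (sym e))
  ... | there h = h
  le' : length L' ≤ length M
  le' = ≤-pred (subst (_≤ suc (length M)) (↭-length L↭) le)

unique-map⇒injective : ∀ (f : A → B) (L : List A) → Unique (map f L) →
                       ∀ {x y} → x ∈ L → y ∈ L → f x ≡ f y → x ≡ y
unique-map⇒injective f (a ∷ L) _        (here refl) (here refl) _ = refl
unique-map⇒injective f (a ∷ L) (pa ∷ _) (here refl) (there y∈)  e = ⊥-elim (All.lookup pa (∈-map⁺ f y∈) e)
unique-map⇒injective f (a ∷ L) (pa ∷ _) (there x∈)  (here refl) e = ⊥-elim (All.lookup pa (∈-map⁺ f x∈) (sym e))
unique-map⇒injective f (a ∷ L) (_ ∷ u)  (there x∈)  (there y∈)  e = unique-map⇒injective f L u x∈ y∈ e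

unique-map⁺ : ∀ (f : A → B) (L : List A) → Unique L →
              (∀ {x y} → x ∈ L → y ∈ L → f x ≡ f y → x ≡ y) → Unique (map f L)
unique-map⁺ f []      _        _   = []
unique-map⁺ f (a ∷ L) (pa ∷ u) inj =
  All.tabulate fa≢ ∷ unique-map⁺ f L u (λ x∈ y∈ → inj (there x∈) (there y∈))
  where
  fa≢ : ∀ {b} → b ∈ map f L → f a ≢ b
  fa≢ b∈ e with ∈-map⁻ f b∈
  ... | z , z∈ , refl = All.lookup pa z∈ (inj (here refl) (there z∈) e)

unique-concatMap⇒injective : ∀ (g : A → List B) (L : List A) → Unique (concatMap g L) →
                             ∀ {a a' z} → a ∈ L → a' ∈ L → z ∈ g a → z ∈ g a' → a ≡ a'
unique-concatMap⇒injective g (b ∷ L) u (here refl) (here refl) _ _ = refl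
unique-concatMap⇒injective g (b ∷ L) u (here refl) (there a'∈) z∈ z∈' =
  ⊥-elim (Unique-++⇒disjoint (g b) u z∈ (∈-concatMap⁺ g (lose a'∈ z∈')))
unique-concatMap⇒injective g (b ∷ L) u (there a∈) (here refl) z∈ z∈' =
  ⊥-elim (Unique-++⇒disjoint (g b) u z∈' (∈-concatMap⁺ g (lose a∈ z∈)))
unique-concatMap⇒injective g (b ∷ L) u (there a∈) (there a'∈) z∈ z∈' =
  unique-concatMap⇒injective g L (Unique-++⁻ʳ (g b) u) a∈ a'∈ z∈ z∈'

unique-concatMap⁻ : ∀ (g : A → List B) (L : List A) → (∀ a → ∃ λ z → z ∈ g a) →
                    Unique (concatMap g L) → Unique L
unique-concatMap⁻ g []      _  _ = []
unique-concatMap⁻ g (b ∷ L) ne u = All.tabulate b≢ ∷ unique-concatMap⁻ g L ne (Unique-++⁻ʳ (g b) u)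
  where
  b≢ : ∀ {a} → a ∈ L → b ≢ a
  b≢ a∈ refl = Unique-++⇒disjoint (g b) u (proj₂ (ne b)) (∈-concatMap⁺ g (lose a∈ (proj₂ (ne b))))

concatMap-pair↭ : ∀ (f g : A → B) (L : List A) → concatMap (λ p → f p ∷ g p ∷ []) L ↭ map f L ++ map g L
concatMap-pair↭ f g []      = ↭.refl
concatMap-pair↭ f g (a ∷ L) =
  prep (f a) (↭-trans (prep (g a) (concatMap-pair↭ f g L)) (↭-sym (shift (g a) (map f L) (map g L))))

length-concatMap-pair : (f g : A → B) (L : List A) →
                        length (concatMap (λ p → f p ∷ g p ∷ []) L) ≡ length L + length L
length-concatMap-pair f g L = trans (↭-length (concatMap-pair↭ f g L))
  (trans (length-++ (map f L)) (cong₂ _+_ (length-map f L) (length-map g L)))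

length-concatMap-map : ∀ {C : Set} (f : A → B → C) (M : List A) (L : List B) →
                       length (concatMap (λ x → map (f x) L) M) ≡ length M * length L
length-concatMap-map f []      L = refl
length-concatMap-map f (x ∷ M) L =
  trans (length-++ (map (f x) L)) (cong₂ _+_ (length-map (f x) L) (length-concatMap-map f M L))

∈-Zstar⁻ : ∀ {k z} → z ∈ Zstar k → 1 ≤ z × z < k
∈-Zstar⁻ {zero}  z∈ with ∈-map⁻ suc z∈
... | _ , () , _
∈-Zstar⁻ {suc k} z∈ with ∈-map⁻ suc z∈
... | i , i∈ , refl = s≤s z≤n , s≤s (∈-upTo⁻ i∈)

∈-Zstar⁺ : ∀ {k z} → 1 ≤ z → z < k → z ∈ Zstar k
∈-Zstar⁺ {suc k} {suc z} _ (s≤s z<k) = ∈-map⁺ suc (∈-upTo⁺ z<k)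

Zstar-unique : ∀ k → Unique (Zstar k)
Zstar-unique k = Unique.map⁺ suc-injective (Unique.upTo⁺ (k ∸ 1))

length-Zstar : ∀ k → length (Zstar k) ≡ k ∸ 1
length-Zstar k = trans (length-map suc (upTo (k ∸ 1))) (length-upTo (k ∸ 1))

unique-in-Zstar⇒↭ : ∀ k (L : List ℕ) → Unique L → (∀ {z} → z ∈ L → 1 ≤ z × z < k) →
                    length L ≡ k ∸ 1 → Zstar k ↭ L
unique-in-Zstar⇒↭ k L u inL len =
  ⊆-unique-length⇒↭ L (Zstar k) u (λ z∈ → ∈-Zstar⁺ (proj₁ (inL z∈)) (proj₂ (inL z∈)))
    (≤-reflexive (trans (length-Zstar k) (sym len)))

covering-Zstar⇒↭ : ∀ k (L : List ℕ) → (∀ {z} → 1 ≤ z → z < k → z ∈ L) → length L ≡ k ∸ 1 →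
                   L ↭ Zstar k
covering-Zstar⇒↭ k L cov len =
  ⊆-unique-length⇒↭ (Zstar k) L (Zstar-unique k)
    (λ z∈ → cov (proj₁ (∈-Zstar⁻ {k} z∈)) (proj₂ (∈-Zstar⁻ {k} z∈)))
    (≤-reflexive (trans len (sym (length-Zstar k))))

pair-list : Pair → List ℕ
pair-list p = proj₁ p ∷ proj₂ p ∷ []

∈-elems⁻ : ∀ {P : List Pair} {z} → z ∈ elems P → ∃ λ p → p ∈ P × (z ≡ proj₁ p ⊎ z ≡ proj₂ p)
∈-elems⁻ z∈ with find (∈-concatMap⁻ pair-list z∈)
... | p , p∈ , here e         = p , p∈ , inj₁ e
... | p , p∈ , there (here e) = p , p∈ , inj₂ e

∈-elems-proj₁ : ∀ {P : List Pair} {p} → p ∈ P → proj₁ p ∈ elems P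
∈-elems-proj₁ p∈ = ∈-concatMap⁺ pair-list (lose p∈ (here refl))

∈-elems-proj₂ : ∀ {P : List Pair} {p} → p ∈ P → proj₂ p ∈ elems P
∈-elems-proj₂ p∈ = ∈-concatMap⁺ pair-list (lose p∈ (there (here refl)))

length-elems : ∀ (P : List Pair) → length (elems P) ≡ length P + length P
length-elems = length-concatMap-pair proj₁ proj₂

module TwoPartitionProperties {k : ℕ} {P : List Pair} (tp : TwoPartition k P) where

  elems-unique : Unique (elems P)
  elems-unique = Unique-resp-↭ (↭-sym tp) (Zstar-unique k)

  unique : Unique P
  unique = unique-concatMap⁻ pair-list P (λ p → proj₁ p , here refl) elems-unique

  ∈-elems⇒range : ∀ {z} → z ∈ elems P → 1 ≤ z × z < k
  ∈-elems⇒range z∈ = ∈-Zstar⁻ (∈-resp-↭ tp z∈)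

  range⇒∈-elems : ∀ {z} → 1 ≤ z → z < k → z ∈ elems P
  range⇒∈-elems 1≤z z<k = ∈-resp-↭ (↭-sym tp) (∈-Zstar⁺ 1≤z z<k)

  length-double : length P + length P ≡ k ∸ 1
  length-double = trans (sym (length-elems P)) (trans (↭-length tp) (length-Zstar k))

  components-distinct : ∀ {x y} → (x , y) ∈ P → x ≢ y
  components-distinct = go elems-unique
    where
    go : ∀ {Q : List Pair} → Unique (elems Q) → ∀ {x y} → (x , y) ∈ Q → x ≢ y
    go ((x≢y ∷ _) ∷ _) (here refl) = x≢y
    go (_ ∷ (_ ∷ u))   (there x∈)  = go u x∈

  range : ∀ {x y} → (x , y) ∈ P → (1 ≤ x × x < k) × (1 ≤ y × y < k) × x ≢ y
  range p∈ = ∈-elems⇒range (∈-elems-proj₁ p∈) , ∈-elems⇒range (∈-elems-proj₂ p∈) , components-distinct p∈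

  proj₁-≥1 : ∀ {x y} → (x , y) ∈ P → 1 ≤ x
  proj₁-≥1 p∈ = proj₁ (proj₁ (range p∈))

  proj₁-< : ∀ {x y} → (x , y) ∈ P → x < k
  proj₁-< p∈ = proj₂ (proj₁ (range p∈))

  proj₂-< : ∀ {x y} → (x , y) ∈ P → y < k
  proj₂-< p∈ = proj₂ (proj₁ (proj₂ (range p∈)))

swap-pair : Pair → Pair
swap-pair (a , b) = b , a

SameUnordered⇒ : ∀ {a b} → SameUnordered a b → a ≡ b ⊎ a ≡ swap-pair b
SameUnordered⇒ (inj₁ (refl , refl)) = inj₁ refl
SameUnordered⇒ (inj₂ (refl , refl)) = inj₂ refl

ordered-of : ∀ {S̃ S} → IsOrdering S̃ S → ∀ {p} → p ∈ S →
             ∃ λ p' → p' ∈ S̃ × (p' ≡ p ⊎ p' ≡ swap-pair p)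
ordered-of (x ∷ _) (here refl) = _ , here refl , SameUnordered⇒ x
ordered-of (_ ∷ o) (there p∈) with ordered-of o p∈
... | p' , p'∈ , s = p' , there p'∈ , s

unordered-of : ∀ {S̃ S} → IsOrdering S̃ S → ∀ {p'} → p' ∈ S̃ →
               ∃ λ p → p ∈ S × (p' ≡ p ⊎ p' ≡ swap-pair p)
unordered-of (x ∷ _) (here refl) = _ , here refl , SameUnordered⇒ x
unordered-of (_ ∷ o) (there p'∈) with unordered-of o p'∈
... | p , p∈ , s = p , there p∈ , s

ordering-map : ∀ {C : Set} {S̃ S} → IsOrdering S̃ S → (f : Pair → C) → (∀ a b → f (a , b) ≡ f (b , a)) →
               map f S̃ ≡ map f S
ordering-map [] f f-swap = refl
ordering-map {S̃ = a ∷ _} {b ∷ _} (x ∷ o) f f-swap with SameUnordered⇒ x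
... | inj₁ refl = cong (f a ∷_) (ordering-map o f f-swap)
... | inj₂ refl = cong₂ _∷_ (f-swap (proj₂ b) (proj₁ b)) (ordering-map o f f-swap)

ordering-elems↭ : ∀ {S̃ S} → IsOrdering S̃ S → elems S̃ ↭ elems S
ordering-elems↭ [] = ↭.refl
ordering-elems↭ (x ∷ o) with SameUnordered⇒ x
... | inj₁ refl = prep _ (prep _ (ordering-elems↭ o))
... | inj₂ refl = swap _ _ (ordering-elems↭ o)

ordering-TwoPartition : ∀ {k S̃ S} → IsOrdering S̃ S → TwoPartition k S → TwoPartition k S̃
ordering-TwoPartition o tp = ↭-trans (ordering-elems↭ o) tp

-- Congruences of integers

infix 4 _≡[_]_

record _≡[_]_ (a : ℤ) (k : ℕ) (b : ℤ) : Set where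
  constructor congruent
  field
    quotient : ℤ
    equation : a ≡ b +ᶻ quotient *ᶻ + k

≡⇒≡ₘ : ∀ {a b k} → a ≡ b → a ≡[ k ] b
≡⇒≡ₘ {a} {k = k} refl = congruent (+ 0) (identity a (+ k))
  where
  identity : ∀ a k → a ≡ a +ᶻ + 0 *ᶻ k
  identity = solve-∀

≡ₘ-refl : ∀ {a k} → a ≡[ k ] a
≡ₘ-refl = ≡⇒≡ₘ refl

≡ₘ-sym : ∀ {a b k} → a ≡[ k ] b → b ≡[ k ] a
≡ₘ-sym {b = b} {k} (congruent c refl) = congruent (-ᶻ c) (identity b c (+ k))
  where
  identity : ∀ b c k → b ≡ (b +ᶻ c *ᶻ k) +ᶻ (-ᶻ c) *ᶻ k
  identity = solve-∀

≡ₘ-trans : ∀ {a b d k} → a ≡[ k ] b → b ≡[ k ] d → a ≡[ k ] d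
≡ₘ-trans {d = d} {k} (congruent c refl) (congruent c' refl) = congruent (c' +ᶻ c) (identity d c c' (+ k))
  where
  identity : ∀ d c c' k → (d +ᶻ c' *ᶻ k) +ᶻ c *ᶻ k ≡ d +ᶻ (c' +ᶻ c) *ᶻ k
  identity = solve-∀

≡ₘ-setoid : ℕ → Setoid _ _
≡ₘ-setoid k = record
  { Carrier       = ℤ
  ; _≈_           = λ a b → a ≡[ k ] b
  ; isEquivalence = record { refl = ≡ₘ-refl ; sym = ≡ₘ-sym ; trans = ≡ₘ-trans }
  }

module ≡ₘ-Reasoning (k : ℕ) = SetoidReasoning (≡ₘ-setoid k)

+-congₘ : ∀ {a b a' b' k} → a ≡[ k ] b → a' ≡[ k ] b' → a +ᶻ a' ≡[ k ] b +ᶻ b'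
+-congₘ {b = b} {b' = b'} {k} (congruent c refl) (congruent c' refl) =
  congruent (c +ᶻ c') (identity b b' c c' (+ k))
  where
  identity : ∀ b b' c c' k → (b +ᶻ c *ᶻ k) +ᶻ (b' +ᶻ c' *ᶻ k) ≡ (b +ᶻ b') +ᶻ (c +ᶻ c') *ᶻ k
  identity = solve-∀

neg-congₘ : ∀ {a b k} → a ≡[ k ] b → -ᶻ a ≡[ k ] -ᶻ b
neg-congₘ {b = b} {k} (congruent c refl) = congruent (-ᶻ c) (identity b c (+ k))
  where
  identity : ∀ b c k → -ᶻ (b +ᶻ c *ᶻ k) ≡ -ᶻ b +ᶻ (-ᶻ c) *ᶻ k
  identity = solve-∀

neg-difference : ∀ a b → -ᶻ (a -ᶻ b) ≡ b -ᶻ a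
neg-difference = solve-∀

-‿congₘ : ∀ {a b a' b' k} → a ≡[ k ] b → a' ≡[ k ] b' → a -ᶻ a' ≡[ k ] b -ᶻ b'
-‿congₘ p q = +-congₘ p (neg-congₘ q)

+-multipleₘ : ∀ a c k → a +ᶻ c *ᶻ + k ≡[ k ] a
+-multipleₘ a c k = congruent c refl

multiple-+ₘ : ∀ k c a → + k *ᶻ c +ᶻ a ≡[ k ] a
multiple-+ₘ k c a = congruent c (identity (+ k) c a)
  where
  identity : ∀ k c a → k *ᶻ c +ᶻ a ≡ a +ᶻ c *ᶻ k
  identity = solve-∀

multiple≡0ₘ : ∀ c k → + k *ᶻ c ≡[ k ] + 0
multiple≡0ₘ c k = congruent c (identity (+ k) c)
  where
  identity : ∀ k c → k *ᶻ c ≡ + 0 +ᶻ c *ᶻ k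
  identity = solve-∀

*-congₘ : ∀ {a b} n m → a ≡[ m ] b → + n *ᶻ a ≡[ n * m ] + n *ᶻ b
*-congₘ {b = b} n m (congruent c refl) =
  congruent c (trans (identity (+ n) b c (+ m)) (cong (λ u → + n *ᶻ b +ᶻ c *ᶻ u) (sym (ℤ.pos-* n m))))
  where
  identity : ∀ n b c m → n *ᶻ (b +ᶻ c *ᶻ m) ≡ n *ᶻ b +ᶻ c *ᶻ (n *ᶻ m)
  identity = solve-∀

*-cancelˡₘ : ∀ {a b} n m → + suc n *ᶻ a ≡[ suc n * m ] + suc n *ᶻ b → a ≡[ m ] b
*-cancelˡₘ {a} {b} n m (congruent c e) = congruent c (ℤ.*-cancelˡ-≡ (+ suc n) a (b +ᶻ c *ᶻ + m)
  (trans e (trans (cong (λ u → + suc n *ᶻ b +ᶻ c *ᶻ u) (ℤ.pos-* (suc n) m)) (identity (+ suc n) b c (+ m)))))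
  where
  identity : ∀ n b c m → n *ᶻ b +ᶻ c *ᶻ (n *ᶻ m) ≡ n *ᶻ (b +ᶻ c *ᶻ m)
  identity = solve-∀

≡ₘ-weaken : ∀ {a b} n m → a ≡[ n * m ] b → a ≡[ n ] b
≡ₘ-weaken {b = b} n m (congruent c refl) =
  congruent (c *ᶻ + m) (trans (cong (λ u → b +ᶻ c *ᶻ u) (ℤ.pos-* n m)) (identity b c (+ n) (+ m)))
  where
  identity : ∀ b c n m → b +ᶻ c *ᶻ (n *ᶻ m) ≡ b +ᶻ (c *ᶻ m) *ᶻ n
  identity = solve-∀

-- a nonzero quotient would put one of a and b above k
≡ₘ⇒≡ : ∀ {a b k} → a < k → b < k → + a ≡[ k ] + b → a ≡ b
≡ₘ⇒≡ {b = b} {k} _ _ (congruent (+ zero) e) = ℤ.+-injective (trans e (identity (+ b) (+ k)))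
  where
  identity : ∀ b k → b +ᶻ + 0 *ᶻ k ≡ b
  identity = solve-∀
≡ₘ⇒≡ {a} {b} {k} a<k _ (congruent (+ suc c) e) =
  ⊥-elim (<⇒≱ a<k (subst (k ≤_) (sym a≡) (≤-trans (m≤n*m k (suc c)) (m≤n+m (suc c * k) b))))
  where
  a≡ : a ≡ b + suc c * k
  a≡ = ℤ.+-injective (trans e (trans (cong (+ b +ᶻ_) (sym (ℤ.pos-* (suc c) k))) (sym (ℤ.pos-+ b (suc c * k)))))
≡ₘ⇒≡ {a} {b} {k} _ b<k (congruent -[1+ c ] e) =
  ⊥-elim (<⇒≱ b<k (subst (k ≤_) (sym b≡) (≤-trans (m≤n*m k (suc c)) (m≤n+m (suc c * k) a))))
  where
  identity : ∀ b c k → b ≡ (b +ᶻ (-ᶻ c) *ᶻ k) +ᶻ c *ᶻ k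
  identity = solve-∀
  e' : + b ≡ + a +ᶻ + suc c *ᶻ + k
  e' = trans (identity (+ b) (+ suc c) (+ k)) (cong (_+ᶻ + suc c *ᶻ + k) (sym e))
  b≡ : b ≡ a + suc c * k
  b≡ = ℤ.+-injective (trans e' (trans (cong (+ a +ᶻ_) (sym (ℤ.pos-* (suc c) k))) (sym (ℤ.pos-+ a (suc c * k)))))


difference≡0⇒≡ : ∀ {k x y} → x < k → y < k → + x -ᶻ + y ≡[ k ] + 0 → x ≡ y
difference≡0⇒≡ {k} {x} {y} x< y< e = ≡ₘ⇒≡ x< y< (begin
  + x                    ≡⟨ identity (+ x) (+ y) ⟩
  (+ x -ᶻ + y) +ᶻ + y    ≈⟨ +-congₘ e ≡ₘ-refl ⟩
  + 0 +ᶻ + y             ≡⟨ ℤ.+-identityˡ (+ y) ⟩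
  + y                    ∎)
  where
  open ≡ₘ-Reasoning k
  identity : ∀ a b → a ≡ a -ᶻ b +ᶻ b
  identity = solve-∀

-- Arithmetic of ℤ_k on representatives

mod-< : ∀ a k → mod a (suc k) < suc k
mod-< a k = m%n<n a (suc k)

mod-id : ∀ {a k} → a < suc k → mod a (suc k) ≡ a
mod-id = m<n⇒m%n≡m

mod-≡ₘ : ∀ a k → + mod a (suc k) ≡[ suc k ] + a
mod-≡ₘ a k = ≡ₘ-sym (congruent (+ (a / suc k)) (begin
  + a                                       ≡⟨ cong +_ (m≡m%n+[m/n]*n a (suc k)) ⟩
  + (a % suc k + a / suc k * suc k)         ≡⟨ ℤ.pos-+ (a % suc k) (a / suc k * suc k) ⟩
  + (a % suc k) +ᶻ + (a / suc k * suc k)    ≡⟨ cong (+ (a % suc k) +ᶻ_) (ℤ.pos-* (a / suc k) (suc k)) ⟩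
  + (a % suc k) +ᶻ + (a / suc k) *ᶻ + suc k ∎))
  where open ≡-Reasoning

neg-< : ∀ k a → neg (suc k) a < suc k
neg-< k a = mod-< (suc k ∸ mod a (suc k)) k

pos-∸ : ∀ {m n} → n ≤ m → + (m ∸ n) ≡ + m -ᶻ + n
pos-∸ {m} {n} n≤m = trans (sym (ℤ.⊖-≥ n≤m)) (sym (ℤ.[+m]-[+n]≡m⊖n m n))

neg-≡ₘ : ∀ a k → + neg (suc k) a ≡[ suc k ] -ᶻ + a
neg-≡ₘ a k = begin
  + neg (suc k) a            ≈⟨ mod-≡ₘ (suc k ∸ r) k ⟩
  + (suc k ∸ r)              ≡⟨ pos-∸ (<⇒≤ (mod-< a k)) ⟩
  + suc k -ᶻ + r             ≡⟨ identity (+ suc k) (+ r) ⟩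
  -ᶻ + r +ᶻ + 1 *ᶻ + suc k   ≈⟨ +-multipleₘ (-ᶻ + r) (+ 1) (suc k) ⟩
  -ᶻ + r                     ≈⟨ neg-congₘ (mod-≡ₘ a k) ⟩
  -ᶻ + a                     ∎
  where
  open ≡ₘ-Reasoning (suc k)
  r = mod a (suc k)
  identity : ∀ k r → k -ᶻ r ≡ -ᶻ r +ᶻ + 1 *ᶻ k
  identity = solve-∀

add-≡ₘ : ∀ a b k → + add (suc k) a b ≡[ suc k ] + a +ᶻ + b
add-≡ₘ a b k = ≡ₘ-trans (mod-≡ₘ (a + b) k) (≡⇒≡ₘ (ℤ.pos-+ a b))

sub-≡ₘ : ∀ a b k → + sub (suc k) a b ≡[ suc k ] + a -ᶻ + b
sub-≡ₘ a b k = begin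
  + sub (suc k) a b          ≈⟨ mod-≡ₘ (a + neg (suc k) b) k ⟩
  + (a + neg (suc k) b)      ≡⟨ ℤ.pos-+ a _ ⟩
  + a +ᶻ + neg (suc k) b     ≈⟨ +-congₘ (≡ₘ-refl {+ a}) (neg-≡ₘ b k) ⟩
  + a -ᶻ + b                 ∎
  where open ≡ₘ-Reasoning (suc k)

residue : ∀ k (c : ℤ) → Σ ℕ λ r → r < suc k × + r ≡[ suc k ] c
residue k c = c ℤ.%ℕ suc k , ℤ.n%ℕd<d c (suc k) ,
              ≡ₘ-sym (congruent (c ℤ./ℕ suc k) (ℤ.a≡a%ℕn+[a/ℕn]*n c (suc k)))

neg-involutive : ∀ k a → a < suc k → neg (suc k) (neg (suc k) a) ≡ a
neg-involutive k a a< = ≡ₘ⇒≡ (neg-< k (neg (suc k) a)) a< (begin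
  + neg (suc k) (neg (suc k) a)    ≈⟨ neg-≡ₘ (neg (suc k) a) k ⟩
  -ᶻ + neg (suc k) a               ≈⟨ neg-congₘ (neg-≡ₘ a k) ⟩
  -ᶻ (-ᶻ + a)                      ≡⟨ ℤ.neg-involutive (+ a) ⟩
  + a                              ∎)
  where open ≡ₘ-Reasoning (suc k)

neg≡0⇒≡0 : ∀ k a → a < suc k → neg (suc k) a ≡ 0 → a ≡ 0
neg≡0⇒≡0 k a a< e = ≡ₘ⇒≡ a< (s≤s z≤n) (begin
  + a                    ≡⟨ sym (ℤ.neg-involutive (+ a)) ⟩
  -ᶻ (-ᶻ + a)            ≈⟨ neg-congₘ (≡ₘ-sym (neg-≡ₘ a k)) ⟩
  -ᶻ + neg (suc k) a     ≡⟨ cong (λ u → -ᶻ + u) e ⟩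
  + 0                    ∎)
  where open ≡ₘ-Reasoning (suc k)

neg-positive : ∀ k {a} → 1 ≤ a → a < suc k → 1 ≤ neg (suc k) a
neg-positive k {a} 1≤a a< = n≢0⇒n>0 (λ e → <⇒≢ 1≤a (sym (neg≡0⇒≡0 k a a< e)))

neg≡∸ : ∀ k {r} → 1 ≤ r → r < suc k → neg (suc k) r ≡ suc k ∸ r
neg≡∸ k {r} 1≤r r< =
  trans (cong (λ u → mod (suc k ∸ u) (suc k)) (mod-id r<)) (mod-id (∸-monoʳ-< 1≤r (<⇒≤ r<)))

sub≢0 : ∀ k {x y} → x < suc k → y < suc k → x ≢ y → sub (suc k) x y ≢ 0
sub≢0 k {x} {y} x< y< x≢y e =
  x≢y (difference≡0⇒≡ x< y< (≡ₘ-trans (≡ₘ-sym (sub-≡ₘ x y k)) (≡⇒≡ₘ (cong +_ e))))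

even≢odd-+ : ∀ a b → a + a ≢ suc (b + b)
even≢odd-+ a b e = even≢odd a b (begin
  2 * a          ≡⟨ cong (λ u → a + u) (+-identityʳ a) ⟩
  a + a          ≡⟨ e ⟩
  suc (b + b)    ≡⟨ cong (λ u → suc (b + u)) (sym (+-identityʳ b)) ⟩
  suc (2 * b)    ∎)
  where open ≡-Reasoning

neg-fixpoint-free : ∀ {ℓ k a} → ℓ + ℓ ≡ k → 1 ≤ a → a < suc k → neg (suc k) a ≢ a
neg-fixpoint-free {ℓ} {a = a} refl 1≤a a< e = even≢odd-+ a ℓ (begin
  a + a                          ≡⟨ cong (_+ a) (sym (trans (sym (neg≡∸ (ℓ + ℓ) 1≤a a<)) e)) ⟩
  (suc (ℓ + ℓ) ∸ a) + a          ≡⟨ m∸n+n≡m (<⇒≤ a<) ⟩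
  suc (ℓ + ℓ)                    ∎)
  where open ≡-Reasoning

infix 4 _≡±[_]_

_≡±[_]_ : ℤ → ℕ → ℤ → Set
a ≡±[ k ] d = a ≡[ k ] d ⊎ a ≡[ k ] -ᶻ d

≡±-neg : ∀ {a k d} → a ≡±[ k ] d → a ≡±[ k ] -ᶻ d
≡±-neg {d = d} (inj₁ a≡d)  = inj₂ (≡ₘ-trans a≡d (≡⇒≡ₘ (sym (ℤ.neg-involutive d))))
≡±-neg         (inj₂ a≡-d) = inj₁ a≡-d

≡±-congʳ : ∀ {a k d d'} → d ≡[ k ] d' → a ≡±[ k ] d → a ≡±[ k ] d'
≡±-congʳ d≡d' (inj₁ a≡d)  = inj₁ (≡ₘ-trans a≡d d≡d')
≡±-congʳ d≡d' (inj₂ a≡-d) = inj₂ (≡ₘ-trans a≡-d (neg-congₘ d≡d'))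

≡±-weaken : ∀ {a d} n m → a ≡±[ n * m ] d → a ≡±[ n ] d
≡±-weaken n m (inj₁ a≡d)  = inj₁ (≡ₘ-weaken n m a≡d)
≡±-weaken n m (inj₂ a≡-d) = inj₂ (≡ₘ-weaken n m a≡-d)

≡±-zeroʳ : ∀ {a k d} → d ≡[ k ] + 0 → a ≡±[ k ] d → a ≡[ k ] + 0
≡±-zeroʳ d≡0 (inj₁ a≡d)  = ≡ₘ-trans a≡d d≡0
≡±-zeroʳ d≡0 (inj₂ a≡-d) = ≡ₘ-trans a≡-d (neg-congₘ d≡0)

≡±-zeroˡ : ∀ {a k d} → a ≡[ k ] + 0 → a ≡±[ k ] d → d ≡[ k ] + 0
≡±-zeroˡ a≡0 (inj₁ a≡d)  = ≡ₘ-trans (≡ₘ-sym a≡d) a≡0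
≡±-zeroˡ {d = d} a≡0 (inj₂ a≡-d) = begin
  d              ≡⟨ sym (ℤ.neg-involutive d) ⟩
  -ᶻ (-ᶻ d)      ≈⟨ neg-congₘ (≡ₘ-trans (≡ₘ-sym a≡-d) a≡0) ⟩
  -ᶻ (+ 0)       ≡⟨⟩
  + 0            ∎
  where open ≡ₘ-Reasoning _

≡±-*-cong : ∀ {a d} n m → a ≡±[ m ] d → + n *ᶻ a ≡±[ n * m ] + n *ᶻ d
≡±-*-cong n m (inj₁ a≡d)  = inj₁ (*-congₘ n m a≡d)
≡±-*-cong {d = d} n m (inj₂ a≡-d) =
  inj₂ (≡ₘ-trans (*-congₘ n m a≡-d) (≡⇒≡ₘ (sym (ℤ.neg-distribʳ-* (+ n) d))))

≡±-*-cancelˡ : ∀ {a d} n m → + suc n *ᶻ a ≡±[ suc n * m ] + suc n *ᶻ d → a ≡±[ m ] d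
≡±-*-cancelˡ n m (inj₁ na≡nd)  = inj₁ (*-cancelˡₘ n m na≡nd)
≡±-*-cancelˡ {d = d} n m (inj₂ na≡-nd) =
  inj₂ (*-cancelˡₘ n m (≡ₘ-trans na≡-nd (≡⇒≡ₘ (ℤ.neg-distribʳ-* (+ suc n) d))))

-- x - y or x + y: op on ℤ, computed on representatives of ℤ_k by f k (sub k or add k)
record SignedOperation : Set where
  field
    f        : ℕ → ℕ → ℕ → ℕ
    op       : ℤ → ℤ → ℤ
    f-≡ₘ     : ∀ k a b → + f (suc k) a b ≡[ suc k ] op (+ a) (+ b)
    f-<      : ∀ k a b → f (suc k) a b < suc k
    op-congₘ : ∀ {a a' b b' k} → a ≡[ k ] a' → b ≡[ k ] b' → op a b ≡[ k ] op a' b'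
    op-swap  : ∀ {z k} a b → z ≡±[ k ] op a b → z ≡±[ k ] op b a
    op-neg   : ∀ a b → op (-ᶻ a) (-ᶻ b) ≡ -ᶻ op a b
    op-zero  : op (+ 0) (+ 0) ≡ + 0
    op-mixed : ∀ n r t x y → op (n *ᶻ r +ᶻ x) (n *ᶻ t +ᶻ y) ≡ n *ᶻ op r t +ᶻ op x y

difference : SignedOperation
difference = record
  { f        = sub
  ; op       = _-ᶻ_
  ; f-≡ₘ     = λ k a b → sub-≡ₘ a b k
  ; f-<      = λ k a b → mod-< (a + neg (suc k) b) k
  ; op-congₘ = -‿congₘ
  ; op-swap  = λ a b → ≡±-congʳ (≡⇒≡ₘ (neg-difference a b)) ∘ ≡±-neg
  ; op-neg   = solve-∀
  ; op-zero  = refl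
  ; op-mixed = solve-∀
  }

sum : SignedOperation
sum = record
  { f        = add
  ; op       = _+ᶻ_
  ; f-≡ₘ     = λ k a b → add-≡ₘ a b k
  ; f-<      = λ k a b → mod-< (a + b) k
  ; op-congₘ = +-congₘ
  ; op-swap  = λ a b → ≡±-congʳ (≡⇒≡ₘ (ℤ.+-comm a b))
  ; op-neg   = solve-∀
  ; op-zero  = refl
  ; op-mixed = solve-∀
  }

module PlusMinus (σ : SignedOperation) (k : ℕ) where
  open SignedOperation σ

  value : Pair → ℕ
  value p = f (suc k) (proj₁ p) (proj₂ p)

  -- the list ±(x op y) over the pairs (x , y) of P, i.e. pmDiffs (suc k) P or pmSums (suc k) P
  values : List Pair → List ℕ
  values = concatMap (λ p → value p ∷ neg (suc k) (value p) ∷ [])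

  ∈-values⁻ : ∀ {P z} → z ∈ values P → ∃ λ p → p ∈ P × + z ≡±[ suc k ] op (+ proj₁ p) (+ proj₂ p)
  ∈-values⁻ z∈ with find (∈-concatMap⁻ (λ p → value p ∷ neg (suc k) (value p) ∷ []) z∈)
  ... | p , p∈ , here refl         = p , p∈ , inj₁ (f-≡ₘ k _ _)
  ... | p , p∈ , there (here refl) = p , p∈ , inj₂ (≡ₘ-trans (neg-≡ₘ (value p) k) (neg-congₘ (f-≡ₘ k _ _)))

  ∈-values⁺ : ∀ {P p z} → p ∈ P → z < suc k → + z ≡±[ suc k ] op (+ proj₁ p) (+ proj₂ p) → z ∈ values P
  ∈-values⁺ p∈ z< (inj₁ z≡) =
    ∈-concatMap⁺ _ (lose p∈ (here (≡ₘ⇒≡ z< (f-< k _ _) (≡ₘ-trans z≡ (≡ₘ-sym (f-≡ₘ k _ _))))))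
  ∈-values⁺ {p = p} p∈ z< (inj₂ z≡) = ∈-concatMap⁺ _ (lose p∈ (there (here (≡ₘ⇒≡ z< (neg-< k (value p))
    (≡ₘ-trans z≡ (≡ₘ-sym (≡ₘ-trans (neg-≡ₘ (value p) k) (neg-congₘ (f-≡ₘ k _ _)))))))))

  values-in-Zstar : ∀ {P} → (∀ {p} → p ∈ P → value p ≢ 0) → ∀ {z} → z ∈ values P → 1 ≤ z × z < suc k
  values-in-Zstar nz z∈ with find (∈-concatMap⁻ (λ p → value p ∷ neg (suc k) (value p) ∷ []) z∈)
  ... | p , p∈ , here refl         = n≢0⇒n>0 (nz p∈) , f-< k _ _
  ... | p , p∈ , there (here refl) = n≢0⇒n>0 (nz p∈ ∘ neg≡0⇒≡0 k (value p) (f-< k _ _)) , neg-< k (value p)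

  length-values : ∀ P → length (values P) ≡ length P + length P
  length-values = length-concatMap-pair value (λ p → neg (suc k) (value p))

  module _ {P̃ P : List Pair} (o : IsOrdering P̃ P) where

    ∈-values⁻-ordering : ∀ {z} → z ∈ values P →
                         ∃ λ p → p ∈ P̃ × + z ≡±[ suc k ] op (+ proj₁ p) (+ proj₂ p)
    ∈-values⁻-ordering z∈ with ∈-values⁻ z∈
    ... | p , p∈ , z≡ with ordered-of o p∈
    ... | p' , p'∈ , inj₁ refl = p' , p'∈ , z≡
    ... | p' , p'∈ , inj₂ refl = p' , p'∈ , op-swap _ _ z≡

    ∈-values⁺-ordering : ∀ {p z} → p ∈ P̃ → z < suc k → + z ≡±[ suc k ] op (+ proj₁ p) (+ proj₂ p) →
                         z ∈ values P
    ∈-values⁺-ordering p∈ z< z≡ with unordered-of o p∈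
    ... | p' , p'∈ , inj₁ refl = ∈-values⁺ p'∈ z< z≡
    ... | p' , p'∈ , inj₂ refl = ∈-values⁺ p'∈ z< (op-swap _ _ z≡)

Covers : ℕ → List ℕ → Set
Covers k L = ∀ {z} → 1 ≤ z → z < k → z ∈ L

Starter⇒Covers : ∀ {k P} → Starter k P → Covers k (pmDiffs k P)
Starter⇒Covers (_ , cov) 1≤z z<k = proj₂ (cov _) (1≤z , z<k)

Skew⇒Covers : ∀ {k P} → Skew k P → Covers k (pmSums k P)
Skew⇒Covers cov 1≤z z<k = proj₂ (cov _) (1≤z , z<k)

Starter-intro : ∀ {k P} → TwoPartition (suc k) P → Covers (suc k) (pmDiffs (suc k) P) → Starter (suc k) P
Starter-intro {k} {P} tp cov = tp , λ z → PlusMinus.values-in-Zstar difference k nonzero , λ (1≤z , z<) → cov 1≤z z<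
  where
  open TwoPartitionProperties {suc k} {P} tp
  nonzero : ∀ {xy} → xy ∈ P → sub (suc k) (proj₁ xy) (proj₂ xy) ≢ 0
  nonzero xy∈ = sub≢0 k (proj₁-< xy∈) (proj₂-< xy∈) (components-distinct xy∈)

Skew-intro : ∀ {k P} → (∀ {xy} → xy ∈ P → add (suc k) (proj₁ xy) (proj₂ xy) ≢ 0) →
             Covers (suc k) (pmSums (suc k) P) → Skew (suc k) P
Skew-intro {k} nonzero cov z = PlusMinus.values-in-Zstar sum k nonzero , λ (1≤z , z<) → cov 1≤z z<

add-comm : ∀ k a b → add k a b ≡ add k b a
add-comm k a b = cong (λ u → mod u k) (+-comm a b)

pair-sum : ℕ → Pair → ℕ
pair-sum k w = add k (proj₁ w) (proj₂ w)

ordering-sums : ∀ {k S̃ S} → IsOrdering S̃ S → map (pair-sum k) S̃ ≡ map (pair-sum k) S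
ordering-sums {k} o = ordering-map o (pair-sum k) (add-comm k)

ordering-sums-nonzero : ∀ {k S̃ S} → IsOrdering S̃ S → (∀ {w} → w ∈ S → pair-sum k w ≢ 0) →
                        ∀ {w} → w ∈ S̃ → pair-sum k w ≢ 0
ordering-sums-nonzero {k} o nz w∈ with unordered-of o w∈
... | _ , w'∈ , inj₁ refl = nz w'∈
... | (a , b) , w'∈ , inj₂ refl = nz w'∈ ∘ trans (add-comm k a b)

unordering-sums-nonzero : ∀ {k S̃ S} → IsOrdering S̃ S → (∀ {w} → w ∈ S̃ → pair-sum k w ≢ 0) →
                          ∀ {w} → w ∈ S → pair-sum k w ≢ 0
unordering-sums-nonzero {k} o nz {a , b} w∈ with ordered-of o w∈
... | _ , w'∈ , inj₁ refl = nz w'∈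
... | _ , w'∈ , inj₂ refl = nz w'∈ ∘ trans (add-comm k b a)

Skew⇒sums-nonzero : ∀ {k P} → Skew (suc k) P → ∀ {w} → w ∈ P → pair-sum (suc k) w ≢ 0
Skew⇒sums-nonzero sk w∈ e = <⇒≢ (proj₁ (proj₁ (sk _) (∈-concatMap⁺ _ (lose w∈ (here refl))))) (sym e)

Skew⇒pmSums↭Zstar : ∀ {k P} → TwoPartition (suc k) P → Skew (suc k) P → pmSums (suc k) P ↭ Zstar (suc k)
Skew⇒pmSums↭Zstar {k} {P} tp sk = covering-Zstar⇒↭ (suc k) (pmSums (suc k) P) (Skew⇒Covers {suc k} {P} sk)
  (trans (PlusMinus.length-values sum k P) (TwoPartitionProperties.length-double {suc k} {P} tp))

sumᶻ : Pair → ℤ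
sumᶻ w = + proj₁ w +ᶻ + proj₂ w

pair-sum-≡ₘ : ∀ k w → + pair-sum (suc k) w ≡[ suc k ] sumᶻ w
pair-sum-≡ₘ k w = add-≡ₘ (proj₁ w) (proj₂ w) k

pair-sum-≡⇒≡ₘ : ∀ k {w w'} → pair-sum (suc k) w ≡ pair-sum (suc k) w' → sumᶻ w ≡[ suc k ] sumᶻ w'
pair-sum-≡⇒≡ₘ k {w} {w'} e =
  ≡ₘ-trans (≡ₘ-sym (pair-sum-≡ₘ k w)) (≡ₘ-trans (≡⇒≡ₘ (cong +_ e)) (pair-sum-≡ₘ k w'))

≡ₘ⇒pair-sum-≡ : ∀ k {w w'} → sumᶻ w ≡[ suc k ] sumᶻ w' → pair-sum (suc k) w ≡ pair-sum (suc k) w'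
≡ₘ⇒pair-sum-≡ k {w} {w'} e = ≡ₘ⇒≡ (mod-< (proj₁ w + proj₂ w) k) (mod-< (proj₁ w' + proj₂ w') k)
  (≡ₘ-trans (pair-sum-≡ₘ k w) (≡ₘ-trans e (≡ₘ-sym (pair-sum-≡ₘ k w'))))

≡ₘ⇒pair-sum≡0 : ∀ k {w} → sumᶻ w ≡[ suc k ] + 0 → pair-sum (suc k) w ≡ 0
≡ₘ⇒pair-sum≡0 k {w} e =
  ≡ₘ⇒≡ (mod-< (proj₁ w + proj₂ w) k) (s≤s z≤n) (≡ₘ-trans (pair-sum-≡ₘ k w) e)

-- the ± sums of a skew 2-partition are a permutation of ℤ_k^*, hence distinct
Skew⇒Strong : ∀ {k P} → TwoPartition (suc k) P → Skew (suc k) P → Strong (suc k) P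
Skew⇒Strong {k} {P} tp sk = All.tabulate (Skew⇒sums-nonzero sk) , Unique-++⁻ˡ (map sumₖ P) sums±-unique
  where
  sumₖ = pair-sum (suc k)
  sums±-unique : Unique (map sumₖ P ++ map (neg (suc k) ∘ sumₖ) P)
  sums±-unique = Unique-resp-↭ (concatMap-pair↭ sumₖ (neg (suc k) ∘ sumₖ) P)
                   (Unique-resp-↭ (↭-sym (Skew⇒pmSums↭Zstar {k} {P} tp sk)) (Zstar-unique (suc k)))

-- The Skolem condition

half-odd : ∀ {ℓ k} → ℓ + ℓ ≡ k → half (suc k) ≡ ℓ
half-odd {zero}  refl = refl
half-odd {suc ℓ} refl = cong suc (trans (cong ⌊_/2⌋ (+-suc ℓ ℓ)) (half-odd {ℓ} refl))

-- Within h u v says |u - v| ≤ h without truncated subtraction.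
Within : ℕ → ℕ → ℕ → Set
Within h u v = u ≤ v + h × v ≤ u + h

SkolemPair : ℕ → ℕ → ℕ → Set
SkolemPair h u v = (u < v → v ∸ u ≤ h) × (v < u → u ∸ v ≤ h)

Within-sym : ∀ {h u v} → Within h u v → Within h v u
Within-sym (u≤ , v≤) = v≤ , u≤

Within⇒SkolemPair : ∀ {h u v} → Within h u v → SkolemPair h u v
Within⇒SkolemPair {h} {u} {v} (u≤ , v≤) = (λ _ → m≤n+o⇒m∸n≤o v u v≤) , (λ _ → m≤n+o⇒m∸n≤o u v u≤)

SkolemPair⇒Within : ∀ {h u v} → SkolemPair h u v → Within h u v
SkolemPair⇒Within {h} {u} {v} (u<v⇒ , v<u⇒) with <-cmp u v
... | tri< u<v _ _ = ≤-trans (<⇒≤ u<v) (m≤m+n v h) , ≤-trans (m≤n+m∸n v u) (+-monoʳ-≤ u (u<v⇒ u<v))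
... | tri≈ _ refl _ = m≤m+n u h , m≤m+n u h
... | tri> _ _ v<u = ≤-trans (m≤n+m∸n u v) (+-monoʳ-≤ v (v<u⇒ v<u)) , ≤-trans (<⇒≤ v<u) (m≤m+n u h)

Skolem⇒Within : ∀ {k P h} → half k ≡ h → Skolem k P → ∀ {p} → p ∈ P → Within h (proj₁ p) (proj₂ p)
Skolem⇒Within refl sk p∈ = SkolemPair⇒Within (All.lookup sk p∈)

Within⇒Skolem : ∀ {k P h} → half k ≡ h → (∀ {p} → p ∈ P → Within h (proj₁ p) (proj₂ p)) → Skolem k P
Within⇒Skolem refl w = All.tabulate (Within⇒SkolemPair ∘ w)

Within-ordering : ∀ {h S̃ S} → IsOrdering S̃ S →
                  (∀ {p} → p ∈ S → Within h (proj₁ p) (proj₂ p)) →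
                  ∀ {p} → p ∈ S̃ → Within h (proj₁ p) (proj₂ p)
Within-ordering o w p∈ with unordered-of o p∈
... | _ , p'∈ , inj₁ refl = w p'∈
... | _ , p'∈ , inj₂ refl = Within-sym (w p'∈)

Within-unordering : ∀ {h S̃ S} → IsOrdering S̃ S →
                    (∀ {p} → p ∈ S̃ → Within h (proj₁ p) (proj₂ p)) →
                    ∀ {p} → p ∈ S → Within h (proj₁ p) (proj₂ p)
Within-unordering o w p∈ with ordered-of o p∈
... | _ , p'∈ , inj₁ refl = w p'∈
... | _ , p'∈ , inj₂ refl = Within-sym (w p'∈)

Within-∸ : ∀ {h m r t} → r ≤ m → t ≤ m → Within h r t → Within h (m ∸ r) (m ∸ t)
Within-∸ {h} {m} {r} {t} r≤m t≤m (r≤ , t≤) = reflect r t r≤m t≤m t≤ , reflect t r t≤m r≤m r≤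
  where
  reflect : ∀ r t → r ≤ m → t ≤ m → t ≤ r + h → m ∸ r ≤ m ∸ t + h
  reflect r t r≤m t≤m t≤ = +-cancelʳ-≤ r (m ∸ r) (m ∸ t + h) (begin
    m ∸ r + r        ≡⟨ m∸n+n≡m r≤m ⟩
    m                ≡⟨ sym (m∸n+n≡m t≤m) ⟩
    m ∸ t + t        ≤⟨ +-monoʳ-≤ (m ∸ t) t≤ ⟩
    m ∸ t + (r + h)  ≡⟨ identity (m ∸ t) r h ⟩
    m ∸ t + h + r    ∎)
    where
    open ≤-Reasoning
    identity : ∀ a b c → a + (b + c) ≡ a + c + b
    identity = ℕ.solve-∀

Within-mixed-radix : ∀ {n p q r t x y} → Within p r t → Within q x y → Within (q + n * p) (n * r + x) (n * t + y)
Within-mixed-radix {n} {p} {q} {r} {t} {x} {y} (r≤ , t≤) (x≤ , y≤) = bound r t x y r≤ x≤ , bound t r y x t≤ y≤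
  where
  bound : ∀ r t x y → r ≤ t + p → x ≤ y + q → n * r + x ≤ n * t + y + (q + n * p)
  bound r t x y r≤ x≤ = ≤-trans (+-mono-≤ (*-monoʳ-≤ n r≤) x≤) (≤-reflexive (identity n t p y q))
    where
    identity : ∀ n t p y q → n * (t + p) + (y + q) ≡ n * t + y + (q + n * p)
    identity = ℕ.solve-∀

high-digit-≤ : ∀ {n p q a b} → q < n → n * a ≤ n * b + (q + n * p) → a ≤ b + p
high-digit-≤ {n} {p} {q} {a} {b} q<n le with a ≤? b + p
... | yes a≤ = a≤
... | no a≰ = ⊥-elim (<⇒≱ q<n (+-cancelˡ-≤ (n * b + n * p) n q (begin
  n * b + n * p + n       ≡⟨ identity₁ n b p ⟩
  n * suc (b + p)         ≤⟨ *-monoʳ-≤ n (≰⇒> a≰) ⟩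
  n * a                   ≤⟨ le ⟩
  n * b + (q + n * p)     ≡⟨ identity₂ (n * b) q (n * p) ⟩
  n * b + n * p + q       ∎)))
  where
  open ≤-Reasoning
  identity₁ : ∀ n b p → n * b + n * p + n ≡ n * suc (b + p)
  identity₁ = ℕ.solve-∀
  identity₂ : ∀ a b c → a + (b + c) ≡ a + c + b
  identity₂ = ℕ.solve-∀

low-digit-≤ : ∀ {n p q r x y} → n * (r + p) + y ≤ n * r + x + (q + n * p) → y ≤ x + q
low-digit-≤ {n} {p} {q} {r} {x} {y} le =
  +-cancelˡ-≤ (n * r + n * p) y (x + q) (subst₂ _≤_ (identity₁ n r p y) (identity₂ n r x q p) le)
  where
  identity₁ : ∀ n r p y → n * (r + p) + y ≡ n * r + n * p + y
  identity₁ = ℕ.solve-∀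
  identity₂ : ∀ n r x q p → n * r + x + (q + n * p) ≡ n * r + n * p + (x + q)
  identity₂ = ℕ.solve-∀

∸-shift : ∀ {m r t ℓ} → t ≤ m → t ≡ r + ℓ → m ∸ r ≡ m ∸ t + ℓ
∸-shift {m} {r} {t} {ℓ} t≤m refl = +-cancelʳ-≡ r (m ∸ r) (m ∸ t + ℓ) (begin
  m ∸ r + r              ≡⟨ m∸n+n≡m (≤-trans (m≤m+n r ℓ) t≤m) ⟩
  m                      ≡⟨ sym (m∸n+n≡m t≤m) ⟩
  m ∸ t + (r + ℓ)        ≡⟨ cong (λ u → m ∸ t + u) (+-comm r ℓ) ⟩
  m ∸ t + (ℓ + r)        ≡⟨ sym (+-assoc (m ∸ t) ℓ r) ⟩
  m ∸ t + ℓ + r          ∎)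
  where open ≡-Reasoning

-- The alternative t - r ≡ -ℓ would make ℓ + (t ∸ r), strictly between 0 and 2ℓ + 1, a multiple of 2ℓ + 1.
difference-half⇒≡ : ∀ {ℓ k r t} → ℓ + ℓ ≡ k → 1 ≤ ℓ → r < suc k → Within ℓ r t →
                    + ℓ ≡[ suc k ] + r -ᶻ + t → r ≡ t + ℓ
difference-half⇒≡ {ℓ} {r = r} {t} refl 1≤ℓ r< (_ , t≤) ℓ≡ with ≤-total t r
... | inj₁ t≤r = begin
  r              ≡⟨ sym (m∸n+n≡m t≤r) ⟩
  r ∸ t + t      ≡⟨ cong (_+ t) (sym ℓ≡r∸t) ⟩
  ℓ + t          ≡⟨ +-comm ℓ t ⟩
  t + ℓ          ∎
  where
  open ≡-Reasoning
  ℓ≡r∸t : ℓ ≡ r ∸ t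
  ℓ≡r∸t = ≡ₘ⇒≡ (n<1+n+n ℓ) (≤-<-trans (m∸n≤m r t) r<) (≡ₘ-trans ℓ≡ (≡⇒≡ₘ (sym (pos-∸ t≤r))))
    where
    n<1+n+n : ∀ n → n < suc (n + n)
    n<1+n+n n = s≤s (m≤m+n n n)
... | inj₂ r≤t = ⊥-elim (<⇒≢ 1≤ℓ (sym (m+n≡0⇒m≡0 ℓ sum≡0)))
  where
  sum≡0 : ℓ + (t ∸ r) ≡ 0
  sum≡0 = ≡ₘ⇒≡ (s≤s (+-monoʳ-≤ ℓ (m≤n+o⇒m∸n≤o t r t≤))) (s≤s z≤n) (begin
    + (ℓ + (t ∸ r))                  ≡⟨ ℤ.pos-+ ℓ (t ∸ r) ⟩
    + ℓ +ᶻ + (t ∸ r)                 ≈⟨ +-congₘ ℓ≡ ≡ₘ-refl ⟩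
    (+ r -ᶻ + t) +ᶻ + (t ∸ r)        ≡⟨ cong ((+ r -ᶻ + t) +ᶻ_) (pos-∸ r≤t) ⟩
    (+ r -ᶻ + t) +ᶻ (+ t -ᶻ + r)     ≡⟨ identity (+ r) (+ t) ⟩
    + 0                              ∎)
    where
    open ≡ₘ-Reasoning (suc (ℓ + ℓ))
    identity : ∀ a b → a -ᶻ b +ᶻ (b -ᶻ a) ≡ + 0
    identity = solve-∀

-- Mixed-radix representation z = n a + b of ℤ_(nm)

mixed-radix-< : ∀ n m {r x} → r < m → x < n → n * r + x < n * m
mixed-radix-< n m {r} {x} r<m x<n = begin-strict
  n * r + x      <⟨ +-monoʳ-< (n * r) x<n ⟩
  n * r + n      ≡⟨ +-comm (n * r) n ⟩
  n + n * r      ≡⟨ sym (*-suc n r) ⟩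
  n * suc r      ≤⟨ *-monoʳ-≤ n r<m ⟩
  n * m          ∎
  where open ≤-Reasoning

mixed-radix-digits : ∀ n m {z} → z < suc n * m → ∃ λ a → ∃ λ b → a < m × b < suc n × z ≡ suc n * a + b
mixed-radix-digits n m {z} z< =
  z / suc n , z % suc n , m<n*o⇒m/o<n (subst (z <_) (*-comm (suc n) m) z<) , m%n<n z (suc n) , (begin
    z                              ≡⟨ m≡m%n+[m/n]*n z (suc n) ⟩
    z % suc n + z / suc n * suc n  ≡⟨ +-comm (z % suc n) _ ⟩
    z / suc n * suc n + z % suc n  ≡⟨ cong (_+ z % suc n) (*-comm (z / suc n) (suc n)) ⟩
    suc n * (z / suc n) + z % suc n ∎)
  where open ≡-Reasoning

pos-mixed-radix : ∀ n r x → + (n * r + x) ≡ + n *ᶻ + r +ᶻ + x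
pos-mixed-radix n r x = trans (ℤ.pos-+ (n * r) x) (cong (_+ᶻ + x) (ℤ.pos-* n r))

-- The product W_ST

module Product (n' m' : ℕ) {S T S̃ T̄ : List Pair} (tpS : TwoPartition (suc n') S) (tpT : TwoPartition (suc m') T)
               (oS : IsOrdering S̃ S) (oT : IsBarOrdering (suc m') T̄ T) where

  n m N : ℕ
  n = suc n'
  m = suc m'
  N = n * m

  W : List Pair
  W = product n m S̃ T̄

  tpS̃ : TwoPartition n S̃
  tpS̃ = ordering-TwoPartition {n} oS tpS

  tpT̄ : TwoPartition m T̄
  tpT̄ = ordering-TwoPartition {m} (proj₁ oT) tpT

  module S̃ = TwoPartitionProperties {n} {S̃} tpS̃
  module T̄ = TwoPartitionProperties {m} {T̄} tpT̄

  q p : ℕ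
  q = length S̃
  p = length T̄

  q+q≡n' : q + q ≡ n'
  q+q≡n' = S̃.length-double

  p+p≡m' : p + p ≡ m'
  p+p≡m' = T̄.length-double

  negate : Pair → Pair
  negate rt = neg m (proj₁ rt) , neg m (proj₂ rt)

  -- the pairs (r , t) ∈ T̄ ∪ T̄' ∪ {(0 , 0)} giving the high digits of the type (i) pairs
  T̂ : List Pair
  T̂ = T̄ ++ map negate T̄ ++ ((0 , 0) ∷ [])

  data InT̂ : Pair → Set where
    bar    : ∀ {rt} → rt ∈ T̄ → InT̂ rt
    bar'   : ∀ {rt} → rt ∈ T̄ → InT̂ (negate rt)
    origin : InT̂ (0 , 0)

  ∈-T̂⁻ : ∀ {rt} → rt ∈ T̂ → InT̂ rt
  ∈-T̂⁻ rt∈ with ∈-++⁻ T̄ rt∈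
  ... | inj₁ rt∈T̄ = bar rt∈T̄
  ... | inj₂ rt∈' with ∈-++⁻ (map negate T̄) rt∈'
  ... | inj₁ rt∈T̄' with ∈-map⁻ negate rt∈T̄'
  ...   | _ , rt∈T̄ , refl = bar' rt∈T̄
  ∈-T̂⁻ _ | inj₂ _ | inj₂ (here refl) = origin

  ∈-T̂⁺ : ∀ {rt} → InT̂ rt → rt ∈ T̂
  ∈-T̂⁺ (bar rt∈)  = ∈-++⁺ˡ rt∈
  ∈-T̂⁺ (bar' rt∈) = ∈-++⁺ʳ T̄ (∈-++⁺ˡ (∈-map⁺ negate rt∈))
  ∈-T̂⁺ origin     = ∈-++⁺ʳ T̄ (∈-++⁺ʳ (map negate T̄) (here refl))

  T̂-range : ∀ {r t} → (r , t) ∈ T̂ → r < m × t < m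
  T̂-range rt∈ = range (∈-T̂⁻ rt∈)
    where
    range : ∀ {rt} → InT̂ rt → proj₁ rt < m × proj₂ rt < m
    range (bar rt∈)  = T̄.proj₁-< rt∈ , T̄.proj₂-< rt∈
    range (bar' {r , t} _) = neg-< m' r , neg-< m' t
    range origin     = s≤s z≤n , s≤s z≤n

  data InW : Pair → Set where
    type-i  : ∀ {r t x y} → (r , t) ∈ T̂ → (x , y) ∈ S̃ → InW (n * r + x , n * t + y)
    type-ii : ∀ {r t} → (r , t) ∈ T̄ → InW (n * r , n * t)

  private
    type-i-pair : Pair → Pair → Pair
    type-i-pair rt xy = mod (n * proj₁ rt + proj₁ xy) N , mod (n * proj₂ rt + proj₂ xy) N

    type-ii-pair : Pair → Pair
    type-ii-pair rt = mod (n * proj₁ rt) N , mod (n * proj₂ rt) N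

    type-i-pair-≡ : ∀ {r t x y} → (r , t) ∈ T̂ → (x , y) ∈ S̃ →
                    type-i-pair (r , t) (x , y) ≡ (n * r + x , n * t + y)
    type-i-pair-≡ rt∈ xy∈ =
      cong₂ _,_ (mod-id (mixed-radix-< n m (proj₁ (T̂-range rt∈)) (S̃.proj₁-< xy∈)))
                (mod-id (mixed-radix-< n m (proj₂ (T̂-range rt∈)) (S̃.proj₂-< xy∈)))

    type-ii-pair-≡ : ∀ {r t} → (r , t) ∈ T̄ → type-ii-pair (r , t) ≡ (n * r , n * t)
    type-ii-pair-≡ {r} {t} rt∈ = cong₂ _,_ (mod-id (below r (T̄.proj₁-< rt∈)))
                                           (mod-id (below t (T̄.proj₂-< rt∈)))
      where
      below : ∀ r → r < m → n * r < N
      below r r< = subst (_< N) (+-identityʳ (n * r)) (mixed-radix-< n m r< (s≤s z≤n))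

    type-i-list : List Pair
    type-i-list = concatMap (λ rt → map (type-i-pair rt) S̃) T̂

  ∈-W⁻ : ∀ {w} → w ∈ W → InW w
  ∈-W⁻ w∈ with ∈-++⁻ type-i-list w∈
  ... | inj₁ w∈ᵢ with find (∈-concatMap⁻ (λ rt → map (type-i-pair rt) S̃) {T̂} w∈ᵢ)
  ...   | (r , t) , rt∈ , w∈' with ∈-map⁻ (type-i-pair (r , t)) w∈'
  ...     | (x , y) , xy∈ , refl = subst InW (sym (type-i-pair-≡ rt∈ xy∈)) (type-i rt∈ xy∈)
  ∈-W⁻ w∈ | inj₂ w∈ᵢᵢ with ∈-map⁻ type-ii-pair w∈ᵢᵢ
  ... | (r , t) , rt∈ , refl = subst InW (sym (type-ii-pair-≡ rt∈)) (type-ii rt∈)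

  type-i-∈ : ∀ {r t x y} → (r , t) ∈ T̂ → (x , y) ∈ S̃ → (n * r + x , n * t + y) ∈ W
  type-i-∈ {r} {t} rt∈ xy∈ = ∈-++⁺ˡ (subst (_∈ type-i-list) (type-i-pair-≡ rt∈ xy∈)
    (∈-concatMap⁺ (λ rt → map (type-i-pair rt) S̃) (lose rt∈ (∈-map⁺ (type-i-pair (r , t)) xy∈))))

  type-ii-∈ : ∀ {r t} → (r , t) ∈ T̄ → (n * r , n * t) ∈ W
  type-ii-∈ rt∈ =
    ∈-++⁺ʳ type-i-list (subst (_∈ map type-ii-pair T̄) (type-ii-pair-≡ rt∈) (∈-map⁺ type-ii-pair rt∈))

  bar-firsts : Pair → List ℕ
  bar-firsts rt = proj₁ rt ∷ neg m (proj₁ rt) ∷ []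

  bar-firsts↭Zstar : concatMap bar-firsts T̄ ↭ Zstar m
  bar-firsts↭Zstar = covering-Zstar⇒↭ m (concatMap bar-firsts T̄) (λ 1≤z z<m → proj₂ (proj₂ oT _) (1≤z , z<m))
    (trans (length-concatMap-pair proj₁ (λ rt → neg m (proj₁ rt)) T̄) p+p≡m')

  bar-firsts-injective : ∀ {rt rt' z} → rt ∈ T̄ → rt' ∈ T̄ → z ∈ bar-firsts rt → z ∈ bar-firsts rt' → rt ≡ rt'
  bar-firsts-injective =
    unique-concatMap⇒injective bar-firsts T̄ (Unique-resp-↭ (↭-sym bar-firsts↭Zstar) (Zstar-unique m))

  neg-fixpoint-free-m : ∀ {a} → 1 ≤ a → a < m → neg m a ≢ a
  neg-fixpoint-free-m = neg-fixpoint-free {p} p+p≡m'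

  T̂-first-onto : ∀ {a} → a < m → ∃ λ rt → rt ∈ T̂ × proj₁ rt ≡ a
  T̂-first-onto {zero}  _  = (0 , 0) , ∈-T̂⁺ origin , refl
  T̂-first-onto {suc a} a< with find (∈-concatMap⁻ bar-firsts {T̄} (proj₂ (proj₂ oT (suc a)) (s≤s z≤n , a<)))
  ... | rt , rt∈ , here e         = rt , ∈-T̂⁺ (bar rt∈) , sym e
  ... | rt , rt∈ , there (here e) = negate rt , ∈-T̂⁺ (bar' rt∈) , sym e

  -- Otherwise a is a first component; then -a is a second one (as a first one it would lie in the same pair as a,
  -- the ±r_j being distinct, forcing -a = a), so a is a second component of T̄'.
  T̂-second-onto : ∀ {a} → a < m → ∃ λ rt → rt ∈ T̂ × proj₂ rt ≡ a
  T̂-second-onto {zero}  _  = (0 , 0) , ∈-T̂⁺ origin , refl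
  T̂-second-onto {suc a} a< with ∈-elems⁻ {T̄} (T̄.range⇒∈-elems (s≤s z≤n) a<)
  ... | rt , rt∈ , inj₂ e = rt , ∈-T̂⁺ (bar rt∈) , sym e
  ... | (r , t) , rt∈ , inj₁ a≡r
    with ∈-elems⁻ {T̄} (T̄.range⇒∈-elems (neg-positive m' (s≤s z≤n) a<) (neg-< m' (suc a)))
  ...   | (r' , t') , rt'∈ , inj₂ -a≡t' =
    negate (r' , t') , ∈-T̂⁺ (bar' rt'∈) , trans (cong (neg m) (sym -a≡t')) (neg-involutive m' (suc a) a<)
  ...   | (r' , t') , rt'∈ , inj₁ -a≡r' =
    ⊥-elim (neg-fixpoint-free-m (s≤s z≤n) a< (trans -a≡r' (trans (cong proj₁ (sym same)) (sym a≡r))))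
    where
    same : (r , t) ≡ (r' , t')
    same = bar-firsts-injective rt∈ rt'∈ (there (here (cong (neg m) a≡r))) (here -a≡r')

  negate-injective : ∀ {rt rt'} → rt ∈ T̄ → rt' ∈ T̄ → negate rt ≡ negate rt' → rt ≡ rt'
  negate-injective {r , t} {r' , t'} rt∈ rt'∈ e = cong₂ _,_
    (neg-injective (T̄.proj₁-< rt∈) (T̄.proj₁-< rt'∈) (cong proj₁ e))
    (neg-injective (T̄.proj₂-< rt∈) (T̄.proj₂-< rt'∈) (cong proj₂ e))
    where
    neg-injective : ∀ {a b} → a < m → b < m → neg m a ≡ neg m b → a ≡ b
    neg-injective {a} {b} a< b< e = trans (sym (neg-involutive m' a a<)) (trans (cong (neg m) e) (neg-involutive m' b b<))

  T̂-unique : Unique T̂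
  T̂-unique = Unique.++⁺ T̄.unique
    (Unique.++⁺ (unique-map⁺ negate T̄ T̄.unique negate-injective) ([] ∷ []) T̄'∌origin) T̄∩T̄'∪origin≡∅
    where
    T̄'∌origin : ∀ {z} → z ∈ map negate T̄ × z ∈ (0 , 0) ∷ [] → ⊥
    T̄'∌origin (z∈ , here refl) with ∈-map⁻ negate z∈
    ... | (r , t) , rt∈ , e =
      <⇒≢ (T̄.proj₁-≥1 rt∈) (sym (neg≡0⇒≡0 m' r (T̄.proj₁-< rt∈) (sym (cong proj₁ e))))
    T̄∩T̄'∪origin≡∅ : ∀ {z} → z ∈ T̄ × z ∈ map negate T̄ ++ (0 , 0) ∷ [] → ⊥
    T̄∩T̄'∪origin≡∅ {r , t} (z∈ , z∈') with ∈-++⁻ (map negate T̄) z∈'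
    ... | inj₂ (here refl) = <⇒≢ (T̄.proj₁-≥1 z∈) refl
    ... | inj₁ z∈T̄' with ∈-map⁻ negate z∈T̄'
    ...   | (r' , t') , rt'∈ , e = neg-fixpoint-free-m (T̄.proj₁-≥1 rt'∈) (T̄.proj₁-< rt'∈)
            (trans (sym (cong proj₁ e))
                   (cong proj₁ (bar-firsts-injective z∈ rt'∈ (here refl) (there (here (cong proj₁ e))))))

  length-W : length W ≡ length T̂ * q + p
  length-W = trans (length-++ type-i-list)
    (cong₂ _+_ (length-concatMap-map type-i-pair T̂ S̃) (length-map type-ii-pair T̄))

  length-T̂ : length T̂ ≡ p + (p + 1)
  length-T̂ = trans (length-++ T̄)
    (cong (λ u → p + u) (trans (length-++ (map negate T̄)) (cong (_+ 1) (length-map negate T̄))))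

  length-elems-W : length (elems W) ≡ N ∸ 1
  length-elems-W = begin
    length (elems W)                                    ≡⟨ length-elems W ⟩
    length W + length W                                 ≡⟨ cong (λ u → u + u) (trans length-W (cong (λ u → u * q + p) length-T̂)) ⟩
    ((p + (p + 1)) * q + p) + ((p + (p + 1)) * q + p)   ≡⟨ identity p q ⟩
    (p + p) + (q + q) * suc (p + p)                     ≡⟨ cong₂ (λ u v → u + v * suc u) p+p≡m' q+q≡n' ⟩
    m' + n' * suc m'                                    ∎
    where
    open ≡-Reasoning
    identity : ∀ p q → ((p + (p + 1)) * q + p) + ((p + (p + 1)) * q + p) ≡ (p + p) + (q + q) * suc (p + p)
    identity = ℕ.solve-∀

  -- z = n a + b: for b = 0 a type (ii) pair has first or second member n a; otherwise b = x or y for some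
  -- (x , y) ∈ S̃, and a is the first resp. second member of some pair of T̂.
  elems-W-covers : ∀ {z} → 1 ≤ z → z < N → z ∈ elems W
  elems-W-covers {z} 1≤z z< with mixed-radix-digits n' m z<
  ... | zero , zero , _ , _ , refl = ⊥-elim (<⇒≱ 1≤z (≤-reflexive (trans (+-identityʳ (n * 0)) (*-zeroʳ n))))
  ... | suc a , zero , a< , _ , refl with ∈-elems⁻ {T̄} (T̄.range⇒∈-elems (s≤s z≤n) a<)
  ...   | (r , t) , rt∈ , inj₁ refl =
    subst (_∈ elems W) (sym (+-identityʳ (n * r))) (∈-elems-proj₁ {W} (type-ii-∈ rt∈))
  ...   | (r , t) , rt∈ , inj₂ refl =
    subst (_∈ elems W) (sym (+-identityʳ (n * t))) (∈-elems-proj₂ {W} (type-ii-∈ rt∈))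
  elems-W-covers 1≤z z< | a , suc b , a< , b< , refl with ∈-elems⁻ {S̃} (S̃.range⇒∈-elems (s≤s z≤n) b<)
  ... | (x , y) , xy∈ , inj₁ refl with T̂-first-onto a<
  ...   | (r , t) , rt∈ , refl = ∈-elems-proj₁ {W} (type-i-∈ rt∈ xy∈)
  elems-W-covers 1≤z z< | a , suc b , a< , b< , refl | (x , y) , xy∈ , inj₂ refl with T̂-second-onto a<
  ...   | (r , t) , rt∈ , refl = ∈-elems-proj₂ {W} (type-i-∈ rt∈ xy∈)

  W-TwoPartition : TwoPartition N W
  W-TwoPartition = covering-Zstar⇒↭ N (elems W) elems-W-covers length-elems-W

  module W = TwoPartitionProperties {N} {W} W-TwoPartition

  module Covering (σ : SignedOperation) where
    open SignedOperation σ
    open PlusMinus σ using (values; ∈-values⁻; ∈-values⁺; ∈-values⁻-ordering; ∈-values⁺-ordering)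

    opᶻ : Pair → ℤ
    opᶻ w = op (+ proj₁ w) (+ proj₂ w)

    opᶻ-type-i : ∀ r t x y → opᶻ (n * r + x , n * t + y) ≡ + n *ᶻ opᶻ (r , t) +ᶻ opᶻ (x , y)
    opᶻ-type-i r t x y =
      trans (cong₂ op (pos-mixed-radix n r x) (pos-mixed-radix n t y)) (op-mixed (+ n) (+ r) (+ t) (+ x) (+ y))

    opᶻ-type-ii : ∀ r t → opᶻ (n * r , n * t) ≡ + n *ᶻ opᶻ (r , t)
    opᶻ-type-ii r t = begin
      opᶻ (n * r , n * t)                     ≡⟨ cong₂ (λ u v → opᶻ (u , v)) (sym (+-identityʳ (n * r))) (sym (+-identityʳ (n * t))) ⟩
      opᶻ (n * r + 0 , n * t + 0)             ≡⟨ opᶻ-type-i r t 0 0 ⟩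
      + n *ᶻ opᶻ (r , t) +ᶻ op (+ 0) (+ 0)    ≡⟨ cong (+ n *ᶻ opᶻ (r , t) +ᶻ_) op-zero ⟩
      + n *ᶻ opᶻ (r , t) +ᶻ + 0               ≡⟨ ℤ.+-identityʳ _ ⟩
      + n *ᶻ opᶻ (r , t)                      ∎
      where open ≡-Reasoning

    opᶻ-type-i-mod-n : ∀ r t x y → opᶻ (n * r + x , n * t + y) ≡[ n ] opᶻ (x , y)
    opᶻ-type-i-mod-n r t x y =
      ≡ₘ-trans (≡⇒≡ₘ (opᶻ-type-i r t x y)) (multiple-+ₘ n (opᶻ (r , t)) (opᶻ (x , y)))

    opᶻ-type-ii-mod-n : ∀ r t → opᶻ (n * r , n * t) ≡[ n ] + 0
    opᶻ-type-ii-mod-n r t = ≡ₘ-trans (≡⇒≡ₘ (opᶻ-type-ii r t)) (multiple≡0ₘ (opᶻ (r , t)) n)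

    opᶻ-negate : ∀ rt → opᶻ (negate rt) ≡[ m ] -ᶻ opᶻ rt
    opᶻ-negate (r , t) = ≡ₘ-trans (op-congₘ (neg-≡ₘ r m') (neg-≡ₘ t m')) (≡⇒≡ₘ (op-neg (+ r) (+ t)))

    T̂-op-onto : Covers m (values m' T) → ∀ (c : ℤ) → ∃ λ rt → rt ∈ T̂ × opᶻ rt ≡[ m ] c
    T̂-op-onto covT c with residue m' c
    ... | zero   , _   , 0≡c = (0 , 0) , ∈-T̂⁺ origin , ≡ₘ-trans (≡⇒≡ₘ op-zero) 0≡c
    ... | suc c' , c'< , c'≡c with ∈-values⁻-ordering m' (proj₁ oT) (covT (s≤s z≤n) c'<)
    ...   | rt , rt∈ , inj₁ c'≡ = rt , ∈-T̂⁺ (bar rt∈) , ≡ₘ-trans (≡ₘ-sym c'≡) c'≡c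
    ...   | rt , rt∈ , inj₂ c'≡ =
      negate rt , ∈-T̂⁺ (bar' rt∈) , ≡ₘ-trans (opᶻ-negate rt) (≡ₘ-trans (≡ₘ-sym c'≡) c'≡c)

    carry : ∀ {d X a b e} → d ≡[ m ] a -ᶻ e → X ≡ b +ᶻ e *ᶻ + n → + n *ᶻ d +ᶻ X ≡[ N ] + n *ᶻ a +ᶻ b
    carry {d} {X} {a} {b} {e} d≡ refl = begin
      + n *ᶻ d +ᶻ (b +ᶻ e *ᶻ + n)           ≈⟨ +-congₘ (*-congₘ n m d≡) ≡ₘ-refl ⟩
      + n *ᶻ (a -ᶻ e) +ᶻ (b +ᶻ e *ᶻ + n)    ≡⟨ identity (+ n) a e b ⟩
      + n *ᶻ a +ᶻ b                         ∎
      where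
      open ≡ₘ-Reasoning N
      identity : ∀ n a e b → n *ᶻ (a -ᶻ e) +ᶻ (b +ᶻ e *ᶻ n) ≡ n *ᶻ a +ᶻ b
      identity = solve-∀

    W-op-onto-high : Covers m (values m' T) → ∀ {a} → 1 ≤ a → a < m →
                     ∃ λ w → w ∈ W × + (n * a) ≡±[ N ] opᶻ w
    W-op-onto-high covT {a} 1≤a a< with ∈-values⁻-ordering m' (proj₁ oT) (covT 1≤a a<)
    ... | (r , t) , rt∈ , a≡ = (n * r , n * t) , type-ii-∈ rt∈ ,
          ≡±-congʳ (≡⇒≡ₘ (sym (opᶻ-type-ii r t)))
            (subst (λ u → u ≡±[ N ] + n *ᶻ opᶻ (r , t)) (sym (ℤ.pos-* n a)) (≡±-*-cong n m a≡))

    W-op-onto-low : Covers n (values n' S) → Covers m (values m' T) → ∀ {a b} → a < m → 1 ≤ b → b < n →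
                    ∃ λ w → w ∈ W × + (n * a + b) ≡±[ N ] opᶻ w
    W-op-onto-low covS covT {a} {b} a< 1≤b b< with ∈-values⁻-ordering n' oS (covS 1≤b b<)
    ... | (x , y) , xy∈ , inj₁ b≡ with ≡ₘ-sym b≡
    ...   | congruent e xy≡ with T̂-op-onto covT (+ a -ᶻ e)
    ...     | (r , t) , rt∈ , rt≡ = (n * r + x , n * t + y) , type-i-∈ rt∈ xy∈ , inj₁ (≡ₘ-sym (begin
      opᶻ (n * r + x , n * t + y)             ≡⟨ opᶻ-type-i r t x y ⟩
      + n *ᶻ opᶻ (r , t) +ᶻ opᶻ (x , y)       ≈⟨ carry {a = + a} {+ b} {e} rt≡ xy≡ ⟩
      + n *ᶻ + a +ᶻ + b                       ≡⟨ sym (pos-mixed-radix n a b) ⟩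
      + (n * a + b)                           ∎))
      where open ≡ₘ-Reasoning N
    W-op-onto-low covS covT {a} {b} a< 1≤b b< | (x , y) , xy∈ , inj₂ b≡ with ≡ₘ-sym b≡
    ...   | congruent e xy≡ with T̂-op-onto covT (-ᶻ (+ a -ᶻ e))
    ...     | (r , t) , rt∈ , rt≡ = (n * r + x , n * t + y) , type-i-∈ rt∈ xy∈ , inj₂ (≡ₘ-sym (begin
      -ᶻ opᶻ (n * r + x , n * t + y)                  ≡⟨ cong -ᶻ_ (opᶻ-type-i r t x y) ⟩
      -ᶻ (+ n *ᶻ opᶻ (r , t) +ᶻ opᶻ (x , y))          ≡⟨ identity (+ n) (opᶻ (r , t)) (opᶻ (x , y)) ⟩
      + n *ᶻ (-ᶻ opᶻ (r , t)) +ᶻ -ᶻ opᶻ (x , y)       ≈⟨ carry {a = + a} {+ b} {e} -rt≡ xy≡ ⟩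
      + n *ᶻ + a +ᶻ + b                               ≡⟨ sym (pos-mixed-radix n a b) ⟩
      + (n * a + b)                                   ∎))
      where
      open ≡ₘ-Reasoning N
      identity : ∀ n d X → -ᶻ (n *ᶻ d +ᶻ X) ≡ n *ᶻ (-ᶻ d) +ᶻ -ᶻ X
      identity = solve-∀
      -rt≡ : -ᶻ opᶻ (r , t) ≡[ m ] + a -ᶻ e
      -rt≡ = ≡ₘ-trans (neg-congₘ rt≡) (≡⇒≡ₘ (ℤ.neg-involutive (+ a -ᶻ e)))

    W-values-cover : Covers n (values n' S) → Covers m (values m' T) → Covers N (values (m' + n' * m) W)
    W-values-cover covS covT {z} 1≤z z< with mixed-radix-digits n' m z<
    ... | zero  , zero  , _  , _  , refl = ⊥-elim (<⇒≱ 1≤z (≤-reflexive (trans (+-identityʳ (n * 0)) (*-zeroʳ n))))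
    ... | suc a , zero  , a< , _  , refl with W-op-onto-high covT (s≤s z≤n) a<
    ...   | w , w∈ , z≡ =
      ∈-values⁺ _ w∈ z< (subst (λ u → u ≡±[ N ] opᶻ w) (cong +_ (sym (+-identityʳ (n * suc a)))) z≡)
    W-values-cover covS covT 1≤z z< | a , suc b , a< , b< , refl with W-op-onto-low covS covT a< (s≤s z≤n) b<
    ...   | w , w∈ , z≡ = ∈-values⁺ _ w∈ z< z≡

    S-values-cover : Covers N (values (m' + n' * m) W) → Covers n (values n' S)
    S-values-cover covW {c} 1≤c c< with ∈-values⁻ _ (covW 1≤c (<-≤-trans c< (m≤m*n n m)))
    ... | w , w∈ , c≡ = from (∈-W⁻ w∈) (≡±-weaken n m c≡)
      where
      from : ∀ {w} → InW w → + c ≡±[ n ] opᶻ w → c ∈ values n' S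
      from (type-i {r} {t} {x} {y} _ xy∈) c≡ =
        ∈-values⁺-ordering n' oS xy∈ c< (≡±-congʳ (opᶻ-type-i-mod-n r t x y) c≡)
      from (type-ii {r} {t} _) c≡ =
        ⊥-elim (<⇒≢ 1≤c (sym (≡ₘ⇒≡ c< (s≤s z≤n) (≡±-zeroʳ (opᶻ-type-ii-mod-n r t) c≡))))

    T-values-cover : (∀ {x y} → (x , y) ∈ S̃ → ¬ opᶻ (x , y) ≡[ n ] + 0) →
                     Covers N (values (m' + n' * m) W) → Covers m (values m' T)
    T-values-cover op≢0 covW {c} 1≤c c< with ∈-values⁻ _ (covW (*-mono-≤ {1} {n} (s≤s z≤n) 1≤c) (*-monoʳ-< n c<))
    ... | w , w∈ , nc≡ = from (∈-W⁻ w∈) (subst (λ u → u ≡±[ N ] opᶻ w) (ℤ.pos-* n c) nc≡)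
      where
      from : ∀ {w} → InW w → + n *ᶻ + c ≡±[ N ] opᶻ w → c ∈ values m' T
      from (type-i {r} {t} {x} {y} _ xy∈) nc≡ =
        ⊥-elim (op≢0 xy∈ (≡±-zeroˡ (multiple≡0ₘ (+ c) n)
                           (≡±-congʳ (opᶻ-type-i-mod-n r t x y) (≡±-weaken n m nc≡))))
      from (type-ii {r} {t} rt∈) nc≡ =
        ∈-values⁺-ordering m' (proj₁ oT) rt∈ c< (≡±-*-cancelˡ n' m (≡±-congʳ (≡⇒≡ₘ (opᶻ-type-ii r t)) nc≡))

  module Diff = Covering difference
  module Sum = Covering sum

  W-sums-nonzero : (∀ {w} → w ∈ S̃ → pair-sum n w ≢ 0) → (∀ {w} → w ∈ T̄ → pair-sum m w ≢ 0) →
                   ∀ {w} → w ∈ W → pair-sum N w ≢ 0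
  W-sums-nonzero nzS nzT {w} w∈ w≡0 =
    from (∈-W⁻ w∈) (≡ₘ-trans (≡ₘ-sym (pair-sum-≡ₘ _ w)) (≡⇒≡ₘ (cong +_ w≡0)))
    where
    from : ∀ {w} → InW w → sumᶻ w ≡[ N ] + 0 → ⊥
    from (type-i {r} {t} {x} {y} _ xy∈) w≡0 =
      nzS xy∈ (≡ₘ⇒pair-sum≡0 n' {x , y}
                (≡ₘ-trans (≡ₘ-sym (Sum.opᶻ-type-i-mod-n r t x y)) (≡ₘ-weaken n m w≡0)))
    from (type-ii {r} {t} rt∈) w≡0 =
      nzT rt∈ (≡ₘ⇒pair-sum≡0 m' {r , t} (*-cancelˡₘ n' m
                (≡ₘ-trans (≡⇒≡ₘ (sym (Sum.opᶻ-type-ii r t))) (≡ₘ-trans w≡0 (≡⇒≡ₘ (sym (ℤ.*-zeroʳ (+ n))))))))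

  pair-sum-negate : ∀ rt → pair-sum m (negate rt) ≡ neg m (pair-sum m rt)
  pair-sum-negate rt = ≡ₘ⇒≡ (mod-< (proj₁ (negate rt) + proj₂ (negate rt)) m') (neg-< m' (pair-sum m rt)) (begin
    + pair-sum m (negate rt)      ≈⟨ pair-sum-≡ₘ m' (negate rt) ⟩
    sumᶻ (negate rt)              ≈⟨ Sum.opᶻ-negate rt ⟩
    -ᶻ sumᶻ rt                    ≈⟨ neg-congₘ (≡ₘ-sym (pair-sum-≡ₘ m' rt)) ⟩
    -ᶻ + pair-sum m rt            ≈⟨ ≡ₘ-sym (neg-≡ₘ (pair-sum m rt) m') ⟩
    + neg m (pair-sum m rt)       ∎)
    where open ≡ₘ-Reasoning m

  T̄-sums± : List ℕ
  T̄-sums± = map (pair-sum m) T̄ ++ map (neg m ∘ pair-sum m) T̄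

  T̂-sums : map (pair-sum m) T̂ ≡ T̄-sums± ++ (0 ∷ [])
  T̂-sums = begin
    map sumₘ T̂                                       ≡⟨ map-++ sumₘ T̄ _ ⟩
    map sumₘ T̄ ++ map sumₘ (map negate T̄ ++ (0 , 0) ∷ []) ≡⟨ cong (map sumₘ T̄ ++_) (map-++ sumₘ (map negate T̄) _) ⟩
    map sumₘ T̄ ++ map sumₘ (map negate T̄) ++ (0 ∷ [])   ≡⟨ cong (λ l → map sumₘ T̄ ++ l ++ (0 ∷ [])) negated ⟩
    map sumₘ T̄ ++ map (neg m ∘ sumₘ) T̄ ++ (0 ∷ [])      ≡⟨ sym (++-assoc (map sumₘ T̄) _ _) ⟩
    T̄-sums± ++ (0 ∷ [])                              ∎
    where
    open ≡-Reasoning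
    sumₘ = pair-sum m
    negated : map sumₘ (map negate T̄) ≡ map (neg m ∘ sumₘ) T̄
    negated = trans (sym (map-∘ T̄)) (map-cong pair-sum-negate T̄)

  pmSums-T↭T̄-sums± : pmSums m T ↭ T̄-sums±
  pmSums-T↭T̄-sums± = subst (_↭ T̄-sums±) (cong concat (ordering-map (proj₁ oT) pm swap-pm))
                             (concatMap-pair↭ (pair-sum m) (neg m ∘ pair-sum m) T̄)
    where
    pm : Pair → List ℕ
    pm w = pair-sum m w ∷ neg m (pair-sum m w) ∷ []
    swap-pm : ∀ a b → pm (a , b) ≡ pm (b , a)
    swap-pm a b = cong (λ u → u ∷ neg m u ∷ []) (add-comm m a b)

  T̂-sums-unique : Skew m T → Unique (map (pair-sum m) T̂)
  T̂-sums-unique sk = subst Unique (sym T̂-sums) (Unique.++⁺ sums±-unique ([] ∷ []) 0∉)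
    where
    sums±-unique : Unique T̄-sums±
    sums±-unique = Unique-resp-↭ pmSums-T↭T̄-sums±
      (Unique-resp-↭ (↭-sym (Skew⇒pmSums↭Zstar {m'} {T} tpT sk)) (Zstar-unique m))
    0∉ : ∀ {z} → z ∈ T̄-sums± × z ∈ 0 ∷ [] → ⊥
    0∉ (z∈ , here refl) = <⇒≢ (proj₁ (proj₁ (sk 0) (∈-resp-↭ (↭-sym pmSums-T↭T̄-sums±) z∈))) refl

  n*0+b≡b : ∀ b → + n *ᶻ + 0 +ᶻ b ≡ b
  n*0+b≡b b = trans (cong (_+ᶻ b) (ℤ.*-zeroʳ (+ n))) (ℤ.+-identityˡ b)

  high-digits-≡ₘ : ∀ {d d' X} → + n *ᶻ d +ᶻ X ≡[ N ] + n *ᶻ d' +ᶻ X → d ≡[ m ] d'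
  high-digits-≡ₘ {d} {d'} {X} e = *-cancelˡₘ n' m (begin
    + n *ᶻ d                  ≡⟨ identity (+ n *ᶻ d) X ⟩
    + n *ᶻ d +ᶻ X -ᶻ X        ≈⟨ -‿congₘ e (≡ₘ-refl {X}) ⟩
    + n *ᶻ d' +ᶻ X -ᶻ X       ≡⟨ sym (identity (+ n *ᶻ d') X) ⟩
    + n *ᶻ d'                 ∎)
    where
    open ≡ₘ-Reasoning N
    identity : ∀ a b → a ≡ a +ᶻ b -ᶻ b
    identity = solve-∀

  module _ (nzS̃ : ∀ {w} → w ∈ S̃ → pair-sum n w ≢ 0) (uS̃ : Unique (map (pair-sum n) S̃))
           (uT̂ : Unique (map (pair-sum m) T̂)) where

    private
      S̃-sum-injective : ∀ {x y x' y'} → (x , y) ∈ S̃ → (x' , y') ∈ S̃ →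
                        sumᶻ (x , y) ≡[ n ] sumᶻ (x' , y') → (x , y) ≡ (x' , y')
      S̃-sum-injective {x} {y} {x'} {y'} xy∈ xy'∈ e =
        unique-map⇒injective (pair-sum n) S̃ uS̃ xy∈ xy'∈ (≡ₘ⇒pair-sum-≡ n' {x , y} {x' , y'} e)

      T̂-sum-injective : ∀ {r t r' t'} → (r , t) ∈ T̂ → (r' , t') ∈ T̂ →
                        sumᶻ (r , t) ≡[ m ] sumᶻ (r' , t') → (r , t) ≡ (r' , t')
      T̂-sum-injective {r} {t} {r'} {t'} rt∈ rt'∈ e =
        unique-map⇒injective (pair-sum m) T̂ uT̂ rt∈ rt'∈ (≡ₘ⇒pair-sum-≡ m' {r , t} {r' , t'} e)

      low-digits-≢0 : ∀ {x y} → (x , y) ∈ S̃ → ¬ sumᶻ (x , y) ≡[ n ] + 0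
      low-digits-≢0 {x} {y} xy∈ e = nzS̃ xy∈ (≡ₘ⇒pair-sum≡0 n' {x , y} e)

      mixed-types-≢ : ∀ {r t x y r' t'} → (x , y) ∈ S̃ →
                      ¬ sumᶻ (n * r + x , n * t + y) ≡[ N ] sumᶻ (n * r' , n * t')
      mixed-types-≢ {r} {t} {x} {y} {r'} {t'} xy∈ e = low-digits-≢0 xy∈
        (≡ₘ-trans (≡ₘ-sym (Sum.opᶻ-type-i-mod-n r t x y)) (≡ₘ-trans (≡ₘ-weaken n m e) (Sum.opᶻ-type-ii-mod-n r' t')))

    W-sum-injective : ∀ {w w'} → InW w → InW w' → sumᶻ w ≡[ N ] sumᶻ w' → w ≡ w'
    W-sum-injective (type-i {r} {t} {x} {y} rt∈ xy∈) (type-i {r'} {t'} {x'} {y'} rt'∈ xy'∈) e =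
      cong₂ (λ rt xy → n * proj₁ rt + proj₁ xy , n * proj₂ rt + proj₂ xy) rt≡rt' xy≡xy'
      where
      xy≡xy' : (x , y) ≡ (x' , y')
      xy≡xy' = S̃-sum-injective xy∈ xy'∈ (≡ₘ-trans (≡ₘ-sym (Sum.opᶻ-type-i-mod-n r t x y))
                                          (≡ₘ-trans (≡ₘ-weaken n m e) (Sum.opᶻ-type-i-mod-n r' t' x' y')))
      rt≡rt' : (r , t) ≡ (r' , t')
      rt≡rt' = T̂-sum-injective rt∈ rt'∈ (high-digits-≡ₘ {sumᶻ (r , t)} {sumᶻ (r' , t')} {sumᶻ (x , y)}
        (≡ₘ-trans (≡⇒≡ₘ (sym (Sum.opᶻ-type-i r t x y))) (≡ₘ-trans e (≡⇒≡ₘ (trans (Sum.opᶻ-type-i r' t' x' y')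
          (cong (λ xy → + n *ᶻ sumᶻ (r' , t') +ᶻ sumᶻ xy) (sym xy≡xy')))))))
    W-sum-injective (type-i {r} {t} {x} {y} _ xy∈) (type-ii {r'} {t'} _) e =
      ⊥-elim (mixed-types-≢ {r} {t} {x} {y} {r'} {t'} xy∈ e)
    W-sum-injective (type-ii {r'} {t'} _) (type-i {r} {t} {x} {y} _ xy∈) e =
      ⊥-elim (mixed-types-≢ {r} {t} {x} {y} {r'} {t'} xy∈ (≡ₘ-sym e))
    W-sum-injective (type-ii {r} {t} rt∈) (type-ii {r'} {t'} rt'∈) e =
      cong (λ rt → n * proj₁ rt , n * proj₂ rt) (T̂-sum-injective (∈-T̂⁺ (bar rt∈)) (∈-T̂⁺ (bar rt'∈))
        (*-cancelˡₘ {sumᶻ (r , t)} {sumᶻ (r' , t')} n' m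
          (≡ₘ-trans (≡⇒≡ₘ (sym (Sum.opᶻ-type-ii r t))) (≡ₘ-trans e (≡⇒≡ₘ (Sum.opᶻ-type-ii r' t'))))))

  W-Strong : Strong n S → Skew m T → Strong N W
  W-Strong (nzS , uS) skT = All.tabulate (W-sums-nonzero S̃-sums-nonzero (T̄-sums-nonzero)) ,
                            unique-map⁺ (pair-sum N) W W.unique injective
    where
    S̃-sums-nonzero : ∀ {w} → w ∈ S̃ → pair-sum n w ≢ 0
    S̃-sums-nonzero = ordering-sums-nonzero oS (All.lookup nzS)
    T̄-sums-nonzero : ∀ {w} → w ∈ T̄ → pair-sum m w ≢ 0
    T̄-sums-nonzero = ordering-sums-nonzero (proj₁ oT) (Skew⇒sums-nonzero {m'} {T} skT)
    injective : ∀ {w w'} → w ∈ W → w' ∈ W → pair-sum N w ≡ pair-sum N w' → w ≡ w'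
    injective {w} {w'} w∈ w'∈ e =
      W-sum-injective S̃-sums-nonzero (subst Unique (sym (ordering-sums {n} oS)) uS) (T̂-sums-unique skT)
                      (∈-W⁻ w∈) (∈-W⁻ w'∈) (pair-sum-≡⇒≡ₘ (m' + n' * m) {w} {w'} e)

  half-m : half m ≡ p
  half-m = half-odd p+p≡m'

  half-n : half n ≡ q
  half-n = half-odd q+q≡n'

  half-N : half N ≡ q + n * p
  half-N = half-odd (begin
    (q + n * p) + (q + n * p)                          ≡⟨ cong (λ u → (q + suc u * p) + (q + suc u * p)) (sym q+q≡n') ⟩
    (q + suc (q + q) * p) + (q + suc (q + q) * p)      ≡⟨ identity q p ⟩
    (p + p) + (q + q) * suc (p + p)                    ≡⟨ cong₂ (λ u v → u + v * suc u) p+p≡m' q+q≡n' ⟩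
    m' + n' * m                                        ∎)
    where
    open ≡-Reasoning
    identity : ∀ q p → (q + suc (q + q) * p) + (q + suc (q + q) * p) ≡ (p + p) + (q + q) * suc (p + p)
    identity = ℕ.solve-∀

  T̄-Within : Skolem m T → ∀ {rt} → rt ∈ T̄ → Within p (proj₁ rt) (proj₂ rt)
  T̄-Within sk = Within-ordering (proj₁ oT) (Skolem⇒Within {m} {T} half-m sk)

  S̃-Within : Skolem n S → ∀ {xy} → xy ∈ S̃ → Within q (proj₁ xy) (proj₂ xy)
  S̃-Within sk = Within-ordering oS (Skolem⇒Within {n} {S} half-n sk)

  T̂-Within : Skolem m T → ∀ {rt} → rt ∈ T̂ → Within p (proj₁ rt) (proj₂ rt)
  T̂-Within sk rt∈ = within (∈-T̂⁻ rt∈)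
    where
    within : ∀ {rt} → InT̂ rt → Within p (proj₁ rt) (proj₂ rt)
    within (bar rt∈) = T̄-Within sk rt∈
    within (bar' {r , t} rt∈) with T̄.range rt∈
    ... | (1≤r , r<) , (1≤t , t<) , _ = subst₂ (Within p) (sym (neg≡∸ m' 1≤r r<)) (sym (neg≡∸ m' 1≤t t<))
                                          (Within-∸ (<⇒≤ r<) (<⇒≤ t<) (T̄-Within sk rt∈))
    within origin = z≤n , z≤n

  W-Skolem : Skolem n S → Skolem m T → Skolem N W
  W-Skolem skS skT = Within⇒Skolem {N} {W} half-N (within ∘ ∈-W⁻)
    where
    within : ∀ {w} → InW w → Within (q + n * p) (proj₁ w) (proj₂ w)
    within (type-i rt∈ xy∈) = Within-mixed-radix {n} {p} {q} (T̂-Within skT rt∈) (S̃-Within skS xy∈)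
    within (type-ii {r} {t} rt∈) = subst₂ (Within (q + n * p)) (+-identityʳ (n * r)) (+-identityʳ (n * t))
                                     (Within-mixed-radix {n} {p} {q} (T̄-Within skT rt∈) (z≤n {q} , z≤n {q}))

  W-Starter : Starter n S → Starter m T → Starter N W
  W-Starter stS stT = Starter-intro {m' + n' * m} {W} W-TwoPartition
    (Diff.W-values-cover (Starter⇒Covers {n} {S} stS) (Starter⇒Covers {m} {T} stT))

  W-Skew : Skew n S → Skew m T → Skew N W
  W-Skew skS skT = Skew-intro {m' + n' * m} {W}
    (W-sums-nonzero (ordering-sums-nonzero oS (Skew⇒sums-nonzero {n'} {S} skS))
                    (ordering-sums-nonzero (proj₁ oT) (Skew⇒sums-nonzero {m'} {T} skT)))
    (Sum.W-values-cover (Skew⇒Covers {n} {S} skS) (Skew⇒Covers {m} {T} skT))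

  S-Starter : Starter N W → Starter n S
  S-Starter stW = Starter-intro {n'} {S} tpS (Diff.S-values-cover (Starter⇒Covers {N} {W} stW))

  T-Starter : Starter N W → Starter m T
  T-Starter stW = Starter-intro {m'} {T} tpT (Diff.T-values-cover difference≢0 (Starter⇒Covers {N} {W} stW))
    where
    difference≢0 : ∀ {x y} → (x , y) ∈ S̃ → ¬ + x -ᶻ + y ≡[ n ] + 0
    difference≢0 xy∈ e with S̃.range xy∈
    ... | (_ , x<) , (_ , y<) , x≢y = x≢y (difference≡0⇒≡ x< y< e)

  S-Skew : Skew N W → Strong n S → Skew n S
  S-Skew skW (nzS , _) = Skew-intro {n'} {S} (All.lookup nzS) (Sum.S-values-cover (Skew⇒Covers {N} {W} skW))

  q<n : q < n
  q<n = s≤s (subst (q ≤_) q+q≡n' (m≤m+n q q))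

  T-Skolem : Skolem N W → Skolem m T
  T-Skolem skW = Within⇒Skolem {m} {T} half-m (Within-unordering (proj₁ oT) within)
    where
    within : ∀ {rt} → rt ∈ T̄ → Within p (proj₁ rt) (proj₂ rt)
    within {r , t} rt∈ with Skolem⇒Within {N} {W} half-N skW (type-ii-∈ rt∈)
    ... | r≤ , t≤ = high-digit-≤ {n} {p} {q} q<n r≤ , high-digit-≤ {n} {p} {q} q<n t≤

  -- the difference p is realised by a pair of T̄ at distance at most p, hence at distance exactly p
  T̄-distance-p : Starter m T → Skolem m T → 1 ≤ p →
                 ∃ λ rt → rt ∈ T̄ × (proj₁ rt ≡ proj₂ rt + p ⊎ proj₂ rt ≡ proj₁ rt + p)
  T̄-distance-p stT skT 1≤p
    with PlusMinus.∈-values⁻-ordering difference m' (proj₁ oT) (Starter⇒Covers {m} {T} stT 1≤p p<m)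
    where
    p<m : p < m
    p<m = s≤s (subst (p ≤_) p+p≡m' (m≤m+n p p))
  ... | (r , t) , rt∈ , inj₁ p≡r-t =
    (r , t) , rt∈ , inj₁ (difference-half⇒≡ p+p≡m' 1≤p (T̄.proj₁-< rt∈) (T̄-Within skT rt∈) p≡r-t)
  ... | (r , t) , rt∈ , inj₂ p≡t-r =
    (r , t) , rt∈ , inj₂ (difference-half⇒≡ p+p≡m' 1≤p (T̄.proj₂-< rt∈) (Within-sym (T̄-Within skT rt∈))
                            (≡ₘ-trans p≡t-r (≡⇒≡ₘ (neg-difference (+ r) (+ t)))))

  negate-distance : ∀ {a b} → 1 ≤ a → a < m → 1 ≤ b → b < m → a ≡ b + p → neg m b ≡ neg m a + p
  negate-distance 1≤a a< 1≤b b< a≡b+p =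
    trans (neg≡∸ m' 1≤b b<) (trans (∸-shift (<⇒≤ a<) a≡b+p) (cong (_+ p) (sym (neg≡∸ m' 1≤a a<))))

  T̂-distance-p : Starter m T → Skolem m T → 1 ≤ p →
                 (∃ λ rt → rt ∈ T̂ × proj₂ rt ≡ proj₁ rt + p) × (∃ λ rt → rt ∈ T̂ × proj₁ rt ≡ proj₂ rt + p)
  T̂-distance-p stT skT 1≤p with T̄-distance-p stT skT 1≤p
  ... | (r , t) , rt∈ , r-t with T̄.range rt∈ | r-t
  ...   | (1≤r , r<) , (1≤t , t<) , _ | inj₁ r≡t+p =
    (negate (r , t) , ∈-T̂⁺ (bar' rt∈) , negate-distance 1≤r r< 1≤t t< r≡t+p) ,
    ((r , t) , ∈-T̂⁺ (bar rt∈) , r≡t+p)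
  ...   | (1≤r , r<) , (1≤t , t<) , _ | inj₂ t≡r+p =
    ((r , t) , ∈-T̂⁺ (bar rt∈) , t≡r+p) ,
    (negate (r , t) , ∈-T̂⁺ (bar' rt∈) , negate-distance 1≤t t< 1≤r r< t≡r+p)

  -- a type (i) pair whose high digits are at distance exactly p bounds the distance of its low digits by q
  S-Skolem : Skolem N W → Starter m T → Skolem m T → 1 ≤ p → Skolem n S
  S-Skolem skW stT skT 1≤p = Within⇒Skolem {n} {S} half-n (Within-unordering oS within)
    where
    low-digits : ∀ {r t x y} → (r , t) ∈ T̂ → t ≡ r + p → (x , y) ∈ S̃ → y ≤ x + q
    low-digits {r} {t} {x} {y} rt∈ refl xy∈ =
      low-digit-≤ {n} {p} {q} (proj₂ (Skolem⇒Within {N} {W} half-N skW (type-i-∈ rt∈ xy∈)))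
    low-digits' : ∀ {r t x y} → (r , t) ∈ T̂ → r ≡ t + p → (x , y) ∈ S̃ → x ≤ y + q
    low-digits' {r} {t} {x} {y} rt∈ refl xy∈ =
      low-digit-≤ {n} {p} {q} (proj₁ (Skolem⇒Within {N} {W} half-N skW (type-i-∈ rt∈ xy∈)))
    within : ∀ {xy} → xy ∈ S̃ → Within q (proj₁ xy) (proj₂ xy)
    within xy∈ with T̂-distance-p stT skT 1≤p
    ... | (_ , rt∈ , t≡r+p) , (_ , rt'∈ , r'≡t'+p) = low-digits' rt'∈ r'≡t'+p xy∈ , low-digits rt∈ t≡r+p xy∈

  mixed-radix-injective : ∀ {r r' x x'} → x < n → x' < n → n * r + x ≡ n * r' + x' → r ≡ r' × x ≡ x'
  mixed-radix-injective {r} {r'} {x} {x'} x< x'< e =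
    *-cancelˡ-≡ r r' n (+-cancelʳ-≡ x (n * r) (n * r') (trans e (cong (λ u → n * r' + u) (sym x≡x')))) , x≡x'
    where
    x≡x' : x ≡ x'
    x≡x' = ≡ₘ⇒≡ x< x'< (begin
      + x                     ≈⟨ ≡ₘ-sym (multiple-+ₘ n (+ r) (+ x)) ⟩
      + n *ᶻ + r +ᶻ + x       ≡⟨ sym (pos-mixed-radix n r x) ⟩
      + (n * r + x)           ≡⟨ cong +_ e ⟩
      + (n * r' + x')         ≡⟨ pos-mixed-radix n r' x' ⟩
      + n *ᶻ + r' +ᶻ + x'     ≈⟨ multiple-+ₘ n (+ r') (+ x') ⟩
      + x'                    ∎)
      where open ≡ₘ-Reasoning n

  module _ (stW : Strong N W) where

    private
      W-sum-injective' : ∀ {w w'} → w ∈ W → w' ∈ W → sumᶻ w ≡[ N ] sumᶻ w' → w ≡ w'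
      W-sum-injective' {w} {w'} w∈ w'∈ e =
        unique-map⇒injective (pair-sum N) W (proj₂ stW) w∈ w'∈ (≡ₘ⇒pair-sum-≡ (m' + n' * m) {w} {w'} e)

    T̂-sums-unique-from-W : ∀ {x₀ y₀} → (x₀ , y₀) ∈ S̃ → Unique (map (pair-sum m) T̂)
    T̂-sums-unique-from-W {x₀} {y₀} xy₀∈ = unique-map⁺ (pair-sum m) T̂ T̂-unique injective
      where
      x₀< = S̃.proj₁-< xy₀∈
      y₀< = S̃.proj₂-< xy₀∈
      injective : ∀ {rt rt'} → rt ∈ T̂ → rt' ∈ T̂ → pair-sum m rt ≡ pair-sum m rt' → rt ≡ rt'
      injective {r , t} {r' , t'} rt∈ rt'∈ e = cong₂ _,_ (proj₁ (mixed-radix-injective x₀< x₀< (cong proj₁ w≡w')))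
                                                        (proj₁ (mixed-radix-injective y₀< y₀< (cong proj₂ w≡w')))
        where
        w≡w' : (n * r + x₀ , n * t + y₀) ≡ (n * r' + x₀ , n * t' + y₀)
        w≡w' = W-sum-injective' (type-i-∈ rt∈ xy₀∈) (type-i-∈ rt'∈ xy₀∈) (begin
          sumᶻ (n * r + x₀ , n * t + y₀)              ≡⟨ Sum.opᶻ-type-i r t x₀ y₀ ⟩
          + n *ᶻ sumᶻ (r , t) +ᶻ sumᶻ (x₀ , y₀)        ≈⟨ +-congₘ (*-congₘ n m (pair-sum-≡⇒≡ₘ m' {r , t} {r' , t'} e)) ≡ₘ-refl ⟩
          + n *ᶻ sumᶻ (r' , t') +ᶻ sumᶻ (x₀ , y₀)      ≡⟨ sym (Sum.opᶻ-type-i r' t' x₀ y₀) ⟩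
          sumᶻ (n * r' + x₀ , n * t' + y₀)            ∎)
          where open ≡ₘ-Reasoning N

    module _ (skT : Skew m T) where

      -- every residue is the sum of a pair of T̂, so a multiple e n can be cancelled by the high digits
      absorb : ∀ {x y b} → sumᶻ (x , y) ≡[ n ] b →
               ∃ λ rt → rt ∈ T̂ × sumᶻ (n * proj₁ rt + x , n * proj₂ rt + y) ≡[ N ] b
      absorb {x} {y} {b} (congruent e xy≡) with Sum.T̂-op-onto (Skew⇒Covers {m} {T} skT) (+ 0 -ᶻ e)
      ... | (r , t) , rt∈ , rt≡ = (r , t) , rt∈ , (begin
        sumᶻ (n * r + x , n * t + y)              ≡⟨ Sum.opᶻ-type-i r t x y ⟩
        + n *ᶻ sumᶻ (r , t) +ᶻ sumᶻ (x , y)        ≈⟨ Sum.carry {sumᶻ (r , t)} {sumᶻ (x , y)} {+ 0} {b} {e} rt≡ xy≡ ⟩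
        + n *ᶻ + 0 +ᶻ b                           ≡⟨ n*0+b≡b b ⟩
        b                                         ∎)
        where open ≡ₘ-Reasoning N

      S̃-sums-nonzero-from-W : ∀ {xy} → xy ∈ S̃ → pair-sum n xy ≢ 0
      S̃-sums-nonzero-from-W {x , y} xy∈ e = All.lookup (proj₁ stW) (type-i-∈ (proj₁ (proj₂ absorbed)) xy∈)
        (≡ₘ⇒pair-sum≡0 (m' + n' * m) {type-i-of (proj₁ absorbed)} (proj₂ (proj₂ absorbed)))
        where
        type-i-of : Pair → Pair
        type-i-of rt = n * proj₁ rt + x , n * proj₂ rt + y
        absorbed = absorb {x} {y} {+ 0} (pair-sum-≡⇒≡ₘ n' {x , y} {0 , 0} e)

      S̃-sums-injective-from-W : ∀ {xy xy'} → xy ∈ S̃ → xy' ∈ S̃ → pair-sum n xy ≡ pair-sum n xy' → xy ≡ xy'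
      S̃-sums-injective-from-W {x , y} {x' , y'} xy∈ xy'∈ e =
        sym (cong₂ _,_ (proj₂ (mixed-radix-injective x'< x< (cong proj₁ w≡w')))
                       (proj₂ (mixed-radix-injective y'< y< (cong proj₂ w≡w'))))
        where
        x< = S̃.proj₁-< xy∈
        y< = S̃.proj₂-< xy∈
        x'< = S̃.proj₁-< xy'∈
        y'< = S̃.proj₂-< xy'∈
        absorbed = absorb {x'} {y'} {sumᶻ (x , y)} (≡ₘ-sym (pair-sum-≡⇒≡ₘ n' {x , y} {x' , y'} e))
        r = proj₁ (proj₁ absorbed)
        t = proj₂ (proj₁ absorbed)
        w≡w' : (n * r + x' , n * t + y') ≡ (n * 0 + x , n * 0 + y)
        w≡w' = W-sum-injective' (type-i-∈ (proj₁ (proj₂ absorbed)) xy'∈) (type-i-∈ (∈-T̂⁺ origin) xy∈)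
                 (≡ₘ-trans (proj₂ (proj₂ absorbed))
                           (≡⇒≡ₘ (trans (sym (n*0+b≡b (sumᶻ (x , y)))) (sym (Sum.opᶻ-type-i 0 0 x y)))))

      S-Strong-from-W : Strong n S
      S-Strong-from-W = All.tabulate (unordering-sums-nonzero oS S̃-sums-nonzero-from-W) ,
                        subst Unique (ordering-sums {n} oS) (unique-map⁺ (pair-sum n) S̃ S̃.unique S̃-sums-injective-from-W)

  T-Skew-from-T̂ : Unique (map (pair-sum m) T̂) → Skew m T
  T-Skew-from-T̂ u z =
    (λ z∈ → range (∈-resp-↭ pmSums-T↭T̄-sums± z∈)) , λ (1≤z , z<) → ∈-resp-↭ Zstar↭pmSums (∈-Zstar⁺ 1≤z z<)
    where
    u' : Unique (T̄-sums± ++ (0 ∷ []))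
    u' = subst Unique T̂-sums u
    range : ∀ {z} → z ∈ T̄-sums± → 1 ≤ z × z < m
    range z∈ = n≢0⇒n>0 (λ { refl → Unique-++⇒disjoint T̄-sums± u' z∈ (here refl) }) , below z∈
      where
      below : ∀ {z} → z ∈ T̄-sums± → z < m
      below z∈ with ∈-++⁻ (map (pair-sum m) T̄) z∈
      ... | inj₁ z∈ˡ with ∈-map⁻ (pair-sum m) z∈ˡ
      ...   | (r , t) , _ , refl = mod-< (r + t) m'
      below z∈ | inj₂ z∈ʳ with ∈-map⁻ (neg m ∘ pair-sum m) z∈ʳ
      ...   | rt , _ , refl = neg-< m' (pair-sum m rt)
    Zstar↭pmSums : Zstar m ↭ pmSums m T
    Zstar↭pmSums = unique-in-Zstar⇒↭ m (pmSums m T)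
      (Unique-resp-↭ (↭-sym pmSums-T↭T̄-sums±) (Unique-++⁻ˡ T̄-sums± u'))
      (λ z∈ → range (∈-resp-↭ pmSums-T↭T̄-sums± z∈))
      (trans (PlusMinus.length-values sum m' T) T.length-double)
      where module T = TwoPartitionProperties {m} {T} tpT

  W-StrongSkolemStarter : StrongSkolemStarter n S × SkewSkolemStarter m T → StrongSkolemStarter N W
  W-StrongSkolemStarter ((stS , strS , sklS) , (stT , skwT , sklT)) =
    W-Starter stS stT , W-Strong strS skwT , W-Skolem sklS sklT

  W-SkewSkolemStarter : SkewSkolemStarter n S × SkewSkolemStarter m T → SkewSkolemStarter N W
  W-SkewSkolemStarter ((stS , skwS , sklS) , (stT , skwT , sklT)) =
    W-Starter stS stT , W-Skew skwS skwT , W-Skolem sklS sklT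

  module _ (2≤n' : 2 ≤ n') (2≤m' : 2 ≤ m') where

    private
      1≤half : ∀ {ℓ k} → ℓ + ℓ ≡ k → 2 ≤ k → 1 ≤ ℓ
      1≤half {zero} refl ()
      1≤half {suc ℓ} _ _ = s≤s z≤n

      1≤p : 1 ≤ p
      1≤p = 1≤half p+p≡m' 2≤m'

      S̃-inhabited : ∃ λ xy → xy ∈ S̃
      S̃-inhabited with ∈-elems⁻ {S̃} (S̃.range⇒∈-elems {1} ≤-refl (s≤s (≤-trans (s≤s z≤n) 2≤n')))
      ... | xy , xy∈ , _ = xy , xy∈

      factors : Strong N W → Starter N W → Skolem N W →
                (Starter n S × Strong n S × Skolem n S) × (Starter m T × Skew m T × Skolem m T)
      factors strW stW sklW =
        (S-Starter stW , S-Strong-from-W strW skT , S-Skolem sklW stT sklT 1≤p) , (stT , skT , sklT)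
        where
        stT  = T-Starter stW
        sklT = T-Skolem sklW
        skT  = T-Skew-from-T̂ (T̂-sums-unique-from-W strW (proj₂ S̃-inhabited))

    factors-of-StrongSkolemStarter : StrongSkolemStarter N W × ¬ Skew N W →
                                     StrongSkolemStarter n S × ¬ Skew n S × SkewSkolemStarter m T
    factors-of-StrongSkolemStarter ((stW , strW , sklW) , ¬skW) =
      S-factor , (λ skS → ¬skW (W-Skew skS (proj₁ (proj₂ T-factor)))) , T-factor
      where
      S-factor = proj₁ (factors strW stW sklW)
      T-factor = proj₂ (factors strW stW sklW)

    factors-of-SkewSkolemStarter : SkewSkolemStarter N W → SkewSkolemStarter n S × SkewSkolemStarter m T
    factors-of-SkewSkolemStarter (stW , skW , sklW) =
      (proj₁ S-factor , S-Skew skW (proj₁ (proj₂ S-factor)) , proj₂ (proj₂ S-factor)) , T-factor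
      where
      S-factor = proj₁ (factors (Skew⇒Strong {m' + n' * m} {W} W-TwoPartition skW) stW sklW)
      T-factor = proj₂ (factors (Skew⇒Strong {m' + n' * m} {W} W-TwoPartition skW) stW sklW)

theorem3p10 : (n m : ℕ) → 3 ≤ n → Odd n → 3 ≤ m → Odd m →
    (S T S̃ T̄ : List Pair) → TwoPartition n S → TwoPartition m T →
    IsOrdering S̃ S → IsBarOrdering m T̄ T →
    ((StrongSkolemStarter n S × SkewSkolemStarter m T → StrongSkolemStarter (n * m) (product n m S̃ T̄))
     × (SkewSkolemStarter n S × SkewSkolemStarter m T → SkewSkolemStarter (n * m) (product n m S̃ T̄)))
    × ((StrongSkolemStarter (n * m) (product n m S̃ T̄) × ¬ Skew (n * m) (product n m S̃ T̄) →
          StrongSkolemStarter n S × ¬ Skew n S × SkewSkolemStarter m T)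
     × (SkewSkolemStarter (n * m) (product n m S̃ T̄) → SkewSkolemStarter n S × SkewSkolemStarter m T))
-- The oddness hypotheses are redundant: a 2-partition of ℤ_k^* forces k - 1 to be even.
theorem3p10 (suc n') (suc m') (s≤s 2≤n') _ (s≤s 2≤m') _ S T S̃ T̄ tpS tpT oS oT =
  (W-StrongSkolemStarter , W-SkewSkolemStarter) ,
  (factors-of-StrongSkolemStarter 2≤n' 2≤m' , factors-of-SkewSkolemStarter 2≤n' 2≤m')
  where open Product n' m' tpS tpT oS oT
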